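{- Suppose $0<\epsilon\ll\epsilon'\ll d$ and $G$ is an $\epsilon$-regular $3$-partite $3$-complex on $V=V_1\cup V_2\cup V_3$ all of whose parts are defined with all densities $d_S(G)>d$. Then (i) for all but at most $\epsilon'|G_1|$ vertices $v\in G_1$ we have $|G(v)_{23}|=(1\pm\epsilon')|G_{123}|/|G_1|$; (ii) for all but at most $\epsilon'|G_{12}|$ pairs $uv\in G_{12}$ we have $|G(uv)_3|=(1\pm\epsilon')|G_{123}|/|G_{12}|$.
   Context: $0<a\ll b$: the statement holds when $a$ is sufficiently small in terms of $b$ (chains read left to right). $a\pm b$ is a number in $[a-b,a+b]$. A $3$-partite $3$-complex on $V=V_1\cup V_2\cup V_3$ is a down-closed family $G$ of sets meeting each $V_i$ in at most one vertex; $G_I$ is the set of members meeting exactly the classes in $I\subseteq[3]$. $G_I^*$ is the set of sets meeting exactly the classes in $I$ all of whose proper subsets lie in $G$; $d_I(G)=|G_I|/|G_I^*|$. $G(v)_{23}=\{\{a,b\}: a\in V_2,b\in V_3,\{v,a,b\}\in G\}$ and $G(uv)_3=\{w\in V_3:\{u,v,w\}\in G\}$. Restriction: for a subcomplex $J$ (down-closed, $J_I\subseteq G_I$ for its defined parts), $G[J]_I$ consists of $S\in G_I$ with $A\in J$ for every $A\subseteq S$ whose part in $J$ is defined. $G_{ij}$ is $\epsilon$-regular if for all $A\subseteq G_i,B\subseteq G_j$ with $|A|>\epsilon|G_i|,|B|>\epsilon|G_j|$ the edge density between them is $d_{ij}(G)\pm\epsilon$; $G_{123}$ is $\epsilon$-regular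 if for every subcomplex $J$ with $J_{123}$ undefined and $|J^*_{123}|>\epsilon|G^*_{123}|$, $d_{123}(G[J])=d_{123}(G)\pm\epsilon$; $G$ is $\epsilon$-regular if all of these parts are. -}

module Defs where

open import Data.Bool using (Bool; true; false; _∧_; T)
open import Data.Nat as ℕ using (ℕ; zero; suc)
open import Data.Fin using (Fin)
open import Data.Integer using (+_)
open import Data.Product using (_×_)
open import Data.Rational using (ℚ; _/_; 0ℚ; 1ℚ; _+_; _-_; _*_; _≤_; _<_)

count : ∀ {n} → (Fin n → Bool) → ℕ
count {zero}  P = 0
count {suc n} P = (if P Data.Fin.zero then 1 else 0) ℕ.+ count {n} (λ i → P (Data.Fin.suc i))
  where open import Data.Bool using (if_then_else_)

count2 : ∀ {m n} → (Fin m → Fin n → Bool) → ℕ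
count2 {zero}  P = 0
count2 {suc m} P = count (P Data.Fin.zero) ℕ.+ count2 {m} (λ i → P (Data.Fin.suc i))

count3 : ∀ {l m n} → (Fin l → Fin m → Fin n → Bool) → ℕ
count3 {zero}  P = 0
count3 {suc l} P = count2 (P Data.Fin.zero) ℕ.+ count3 {l} (λ i → P (Data.Fin.suc i))

toℚ : ℕ → ℚ
toℚ n = + n / 1

-- ratio m n = m/n as a rational, with the convention m/0 = 0
-- (never used with a zero denominator under the lemma's hypotheses).
ratio : ℕ → ℕ → ℚ
ratio m zero    = 0ℚ
ratio m (suc n) = + m / suc n

_≈_±_ : ℚ → ℚ → ℚ → Set
x ≈ y ± e = (y - e ≤ x) × (x ≤ y + e)

-- A 3-partite 3-complex on V = V₁ ∪ V₂ ∪ V₃ with V_i = Fin n_i,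
-- all of whose parts G_1,G_2,G_3,G_12,G_13,G_23,G_123 are defined
-- (and G_∅ = {∅}).  Down-closure is recorded as fields.

record Complex3 (n₁ n₂ n₃ : ℕ) : Set where
  field
    g1 : Fin n₁ → Bool
    g2 : Fin n₂ → Bool
    g3 : Fin n₃ → Bool
    g12 : Fin n₁ → Fin n₂ → Bool
    g13 : Fin n₁ → Fin n₃ → Bool
    g23 : Fin n₂ → Fin n₃ → Bool
    g123 : Fin n₁ → Fin n₂ → Fin n₃ → Bool
    dc12 : ∀ a b → T (g12 a b) → T (g1 a) × T (g2 b)
    dc13 : ∀ a c → T (g13 a c) → T (g1 a) × T (g3 c)
    dc23 : ∀ b c → T (g23 b c) → T (g2 b) × T (g3 c)
    dc123 : ∀ a b c → T (g123 a b c) → T (g12 a b) × T (g13 a c) × T (g23 b c)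

open Complex3 public

module _ {n₁ n₂ n₃ : ℕ} (G : Complex3 n₁ n₂ n₃) where

  -- G_I^* : sets meeting exactly the classes I, all proper subsets in G
  star12 : Fin n₁ → Fin n₂ → Bool
  star12 a b = g1 G a ∧ g2 G b
  star13 : Fin n₁ → Fin n₃ → Bool
  star13 a c = g1 G a ∧ g3 G c
  star23 : Fin n₂ → Fin n₃ → Bool
  star23 b c = g2 G b ∧ g3 G c
  star123 : Fin n₁ → Fin n₂ → Fin n₃ → Bool
  star123 a b c = g1 G a ∧ g2 G b ∧ g3 G c ∧ g12 G a b ∧ g13 G a c ∧ g23 G b c

  -- G_i^* = V_i since ∅ ∈ G
  d1 d2 d3 d12 d13 d23 d123 : ℚ
  d1 = ratio (count (g1 G)) n₁
  d2 = ratio (count (g2 G)) n₂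
  d3 = ratio (count (g3 G)) n₃
  d12 = ratio (count2 (g12 G)) (count2 star12)
  d13 = ratio (count2 (g13 G)) (count2 star13)
  d23 = ratio (count2 (g23 G)) (count2 star23)
  d123 = ratio (count3 (g123 G)) (count3 star123)

_⊆₁_ : ∀ {n} → (Fin n → Bool) → (Fin n → Bool) → Set
A ⊆₁ B = ∀ x → T (A x) → T (B x)

pairRegular : ℚ → ∀ {m n} → (Fin m → Bool) → (Fin n → Bool)
            → (Fin m → Fin n → Bool) → Set
pairRegular ε {m} {n} Gi Gj Gij =
  ∀ (A : Fin m → Bool) (B : Fin n → Bool) → A ⊆₁ Gi → B ⊆₁ Gj →
  ε * toℚ (count Gi) < toℚ (count A) →
  ε * toℚ (count Gj) < toℚ (count B) →
  ratio (count2 (λ a b → A a ∧ B b ∧ Gij a b)) (count A ℕ.* count B)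
    ≈ ratio (count2 Gij) (count2 (λ a b → Gi a ∧ Gj b)) ± ε

-- Subcomplexes J of G with J_123 undefined.  Parts of J that are
-- "undefined" impose no restriction, which is the same as taking them
-- equal to the corresponding part of G; so w.l.o.g. all parts of size
-- ≤ 2 are defined.

record Sub3 {n₁ n₂ n₃ : ℕ} (G : Complex3 n₁ n₂ n₃) : Set where
  field
    j1 : Fin n₁ → Bool
    j2 : Fin n₂ → Bool
    j3 : Fin n₃ → Bool
    j12 : Fin n₁ → Fin n₂ → Bool
    j13 : Fin n₁ → Fin n₃ → Bool
    j23 : Fin n₂ → Fin n₃ → Bool
    sub1 : j1 ⊆₁ g1 G
    sub2 : j2 ⊆₁ g2 G
    sub3 : j3 ⊆₁ g3 G
    sub12 : ∀ a b → T (j12 a b) → T (g12 G a b)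
    sub13 : ∀ a c → T (j13 a c) → T (g13 G a c)
    sub23 : ∀ b c → T (j23 b c) → T (g23 G b c)
    jdc12 : ∀ a b → T (j12 a b) → T (j1 a) × T (j2 b)
    jdc13 : ∀ a c → T (j13 a c) → T (j1 a) × T (j3 c)
    jdc23 : ∀ b c → T (j23 b c) → T (j2 b) × T (j3 c)

open Sub3 public

module _ {n₁ n₂ n₃ : ℕ} {G : Complex3 n₁ n₂ n₃} (J : Sub3 G) where

  Jstar123 : Fin n₁ → Fin n₂ → Fin n₃ → Bool
  Jstar123 a b c = j1 J a ∧ j2 J b ∧ j3 J c ∧ j12 J a b ∧ j13 J a c ∧ j23 J b c

  r1 : Fin n₁ → Bool
  r1 a = g1 G a ∧ j1 J a
  r2 : Fin n₂ → Bool
  r2 b = g2 G b ∧ j2 J b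
  r3 : Fin n₃ → Bool
  r3 c = g3 G c ∧ j3 J c
  r12 : Fin n₁ → Fin n₂ → Bool
  r12 a b = g12 G a b ∧ j12 J a b ∧ j1 J a ∧ j2 J b
  r13 : Fin n₁ → Fin n₃ → Bool
  r13 a c = g13 G a c ∧ j13 J a c ∧ j1 J a ∧ j3 J c
  r23 : Fin n₂ → Fin n₃ → Bool
  r23 b c = g23 G b c ∧ j23 J b c ∧ j2 J b ∧ j3 J c
  r123 : Fin n₁ → Fin n₂ → Fin n₃ → Bool
  r123 a b c = g123 G a b c ∧ Jstar123 a b c

  rstar123 : Fin n₁ → Fin n₂ → Fin n₃ → Bool
  rstar123 a b c = r1 a ∧ r2 b ∧ r3 c ∧ r12 a b ∧ r13 a c ∧ r23 b c

  d123-restr : ℚ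
  d123-restr = ratio (count3 r123) (count3 rstar123)

tripleRegular : ℚ → ∀ {n₁ n₂ n₃} → Complex3 n₁ n₂ n₃ → Set
tripleRegular ε G =
  ∀ (J : Sub3 G) → ε * toℚ (count3 (star123 G)) < toℚ (count3 (Jstar123 J)) →
  d123-restr J ≈ d123 G ± ε

Regular : ℚ → ∀ {n₁ n₂ n₃} → Complex3 n₁ n₂ n₃ → Set
Regular ε G =
  pairRegular ε (g1 G) (g2 G) (g12 G) ×
  pairRegular ε (g1 G) (g3 G) (g13 G) ×
  pairRegular ε (g2 G) (g3 G) (g23 G) ×
  tripleRegular ε G

DensitiesAbove : ℚ → ∀ {n₁ n₂ n₃} → Complex3 n₁ n₂ n₃ → Set
DensitiesAbove d G =
  d < d1 G × d < d2 G × d < d3 G ×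
  d < d12 G × d < d13 G × d < d23 G × d < d123 G

ConclusionI : ℚ → ∀ {n₁ n₂ n₃} → Complex3 n₁ n₂ n₃ → Set
ConclusionI ε' {n₁} G =
  Σ (Fin n₁ → Bool) λ Bad →
    (toℚ (count Bad) ≤ ε' * toℚ (count (g1 G))) ×
    (∀ v → T (g1 G v) → ¬ T (Bad v) →
       toℚ (count2 (g123 G v)) ≈ r ± (ε' * r))
  where
    open import Data.Product using (Σ)
    open import Relation.Nullary using (¬_)
    r = ratio (count3 (g123 G)) (count (g1 G))

ConclusionII : ℚ → ∀ {n₁ n₂ n₃} → Complex3 n₁ n₂ n₃ → Set
ConclusionII ε' {n₁} {n₂} G =
  Σ (Fin n₁ → Fin n₂ → Bool) λ Bad →
    (toℚ (count2 Bad) ≤ ε' * toℚ (count2 (g12 G))) ×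
    (∀ u v → T (g12 G u v) → ¬ T (Bad u v) →
       toℚ (count (g123 G u v)) ≈ r ± (ε' * r))
  where
    open import Data.Product using (Σ)
    open import Relation.Nullary using (¬_)
    r = ratio (count3 (g123 G)) (count2 (g12 G))

module Submission where

-- Both parts of the lemma are instances of one concentration lemma over a
-- finite index set: the vertices v ∈ G_1 for (i), the pairs uv ∈ G_12 for
-- (ii).  Each element x carries a weight |G*(x)| (triangle candidates over
-- x) and a link |G(x)|.  Triple regularity, tested on the subcomplex whose
-- 12-part is cut down to the pairs over a set B of elements, makes the
-- links a (d123 ± ε)-fraction of the weights on every B carrying more than
-- an ε-fraction of G*_123.  Pair regularity, through a degree lemma, makes
-- all but few elements typical, with weight in a narrow interval.  The
-- outlier lemmas then bound the elements whose link leaves the window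
-- (1 ± ε')·mean: on the set of them the average link would be too large
-- (or too small).

open import Defs
open import Data.Nat as ℕ using (ℕ; zero; suc)
import Data.Nat.Properties as ℕP
open import Data.Integer as ℤ using (+_)
import Data.Integer.Properties as ℤP
open import Data.Rational hiding (floor; ceiling)
open import Data.Rational.Properties
import Data.Rational.Unnormalised as U
import Data.Rational.Unnormalised.Properties as UP
open import Data.Rational.Solver using (module +-*-Solver)
open import Relation.Binary.PropositionalEquality
open import Data.Product using (_×_; _,_; proj₁; proj₂; Σ)
open import Data.Empty using (⊥; ⊥-elim)
open import Data.Fin using (Fin)
import Data.Fin as F
open import Data.Bool using (Bool; true; false; T; _∧_; not; if_then_else_)
open import Data.Bool.Properties using (T-∧; ∧-idempotentCommutativeMonoid)
open import Data.Unit using (tt)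
open import Relation.Nullary using (¬_; Dec; yes; no)
open import Relation.Nullary.Decidable using (⌊_⌋; toWitness)
open import Function.Bundles using (Equivalence)
open import Algebra.Solver.IdempotentCommutativeMonoid ∧-idempotentCommutativeMonoid using (_⊕_; _⊜_)
  renaming (solve to solve-∧)
open +-*-Solver

NonNeg : ℚ → Set
NonNeg x = 0ℚ ≤ x

diff⇒≤ : ∀ {x y} → NonNeg (y - x) → x ≤ y
diff⇒≤ {x} {y} h = subst₂ _≤_ (solve 1 (λ x → x :+ con 0ℚ := x) refl x)
  (solve 2 (λ x y → x :+ (y :- x) := y) refl x y) (+-monoʳ-≤ x h)

≤⇒diff : ∀ {x y} → x ≤ y → NonNeg (y - x)
≤⇒diff {x} {y} h = subst₂ _≤_ (solve 1 (λ x → x :- x := con 0ℚ) refl x) refl (+-monoˡ-≤ (- x) h)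

diff⇒< : ∀ {x y} → 0ℚ < y - x → x < y
diff⇒< {x} {y} h = subst₂ _<_ (solve 1 (λ x → x :+ con 0ℚ := x) refl x)
  (solve 2 (λ x y → x :+ (y :- x) := y) refl x y) (+-monoʳ-< x h)

<⇒diff : ∀ {x y} → x < y → 0ℚ < y - x
<⇒diff {x} {y} h = subst₂ _<_ (solve 1 (λ x → x :- x := con 0ℚ) refl x) refl (+-monoˡ-< (- x) h)

cert≤ : ∀ {x y} e → y - x ≡ e → NonNeg e → x ≤ y
cert≤ e eq h = diff⇒≤ (subst NonNeg (sym eq) h)

cert< : ∀ {x y} e → y - x ≡ e → 0ℚ < e → x < y
cert< e eq h = diff⇒< (subst (0ℚ <_) (sym eq) h)

+-nonneg : ∀ {x y} → NonNeg x → NonNeg y → NonNeg (x + y)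
+-nonneg = +-mono-≤

*-nonneg : ∀ {x y} → NonNeg x → NonNeg y → NonNeg (x * y)
*-nonneg {x} {y} hx hy = subst (_≤ x * y) (*-zeroˡ y) (*-monoʳ-≤-nonNeg y {{nonNegative hy}} hx)

*-pos : ∀ {x y} → 0ℚ < x → 0ℚ < y → 0ℚ < x * y
*-pos {x} {y} hx hy = subst (_< x * y) (*-zeroˡ y) (*-monoˡ-<-pos y {{positive hy}} hx)

+-pos : ∀ {x y} → 0ℚ < x → NonNeg y → 0ℚ < x + y
+-pos = +-mono-<-≤

frac-nonneg : ∀ n d → .{{_ : ℕ.NonZero d}} → NonNeg (+ n / d)
frac-nonneg n d = nonNegative⁻¹ _ {{normalize-nonNeg n d}}

mulˡ : ∀ {a b} c → NonNeg c → a ≤ b → c * a ≤ c * b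
mulˡ c h = *-monoˡ-≤-nonNeg c {{nonNegative h}}

mulʳ : ∀ {a b} c → NonNeg c → a ≤ b → a * c ≤ b * c
mulʳ c h = *-monoʳ-≤-nonNeg c {{nonNegative h}}

mul-mono : ∀ {x X y Y} → NonNeg x → NonNeg Y → x ≤ X → y ≤ Y → x * y ≤ X * Y
mul-mono {x} {X} {y} {Y} hx hY h1 h2 = ≤-trans (mulˡ x hx h2) (mulʳ Y hY h1)

cancelʳ : ∀ {a b} c → 0ℚ < c → a * c ≤ b * c → a ≤ b
cancelʳ c h = *-cancelʳ-≤-pos c {{positive h}}

toℚᵘ-toℚ : ∀ n → toℚᵘ (toℚ n) U.≃ U.mkℚᵘ (+ n) 0
toℚᵘ-toℚ n = toℚᵘ-fromℚᵘ (U.mkℚᵘ (+ n) 0)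

toℚ-+ : ∀ m n → toℚ (m ℕ.+ n) ≡ toℚ m + toℚ n
toℚ-+ m n = toℚᵘ-injective (UP.≃-trans (toℚᵘ-toℚ (m ℕ.+ n))
  (UP.≃-sym (UP.≃-trans (toℚᵘ-homo-+ (toℚ m) (toℚ n))
    (UP.≃-trans (UP.+-cong (toℚᵘ-toℚ m) (toℚᵘ-toℚ n)) (U.*≡* numerators)))))
  where
  numerators : (+ m ℤ.* + 1 ℤ.+ + n ℤ.* + 1) ℤ.* + 1 ≡ + (m ℕ.+ n) ℤ.* + 1
  numerators rewrite ℤP.*-identityʳ (+ m) | ℤP.*-identityʳ (+ n) | ℤP.*-identityʳ (+ m ℤ.+ + n) = refl

toℚ-* : ∀ m n → toℚ (m ℕ.* n) ≡ toℚ m * toℚ n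
toℚ-* m n = toℚᵘ-injective (UP.≃-trans (toℚᵘ-toℚ (m ℕ.* n))
  (UP.≃-sym (UP.≃-trans (toℚᵘ-homo-* (toℚ m) (toℚ n))
    (UP.≃-trans (UP.*-cong (toℚᵘ-toℚ m) (toℚᵘ-toℚ n)) (U.*≡* (cong (ℤ._* + 1) (sym (ℤP.pos-* m n))))))))

toℚ-mono : ∀ {m n} → m ℕ.≤ n → toℚ m ≤ toℚ n
toℚ-mono {m} {n} h = toℚᵘ-cancel-≤ (UP.≤-respʳ-≃ (UP.≃-sym (toℚᵘ-toℚ n))
  (UP.≤-respˡ-≃ (UP.≃-sym (toℚᵘ-toℚ m)) (U.*≤* (ℤP.*-monoʳ-≤-nonNeg (+ 1) (ℤ.+≤+ h)))))

toℚ-nonneg : ∀ n → NonNeg (toℚ n)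
toℚ-nonneg n = toℚ-mono {0} {n} ℕ.z≤n

toℚ-suc-pos : ∀ n → 0ℚ < toℚ (suc n)
toℚ-suc-pos n = positive⁻¹ _ {{normalize-pos (suc n) 1}}

ratio-mul : ∀ m k → ratio m (suc k) * toℚ (suc k) ≡ toℚ m
ratio-mul m k = toℚᵘ-injective (UP.≃-trans (toℚᵘ-homo-* (ratio m (suc k)) (toℚ (suc k)))
  (UP.≃-trans (UP.*-cong (toℚᵘ-fromℚᵘ (U.mkℚᵘ (+ m) k)) (toℚᵘ-toℚ (suc k)))
  (UP.≃-trans (U.*≡* numerators) (UP.≃-sym (toℚᵘ-toℚ m)))))
  where
  numerators : (+ m ℤ.* + suc k) ℤ.* + 1 ≡ + m ℤ.* + (suc k ℕ.* 1)
  numerators rewrite ℤP.*-identityʳ (+ m ℤ.* + suc k) | ℕP.*-identityʳ k = refl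

ratio-eq : ∀ m n → 0ℚ < toℚ n → ratio m n * toℚ n ≡ toℚ m
ratio-eq m zero h = ⊥-elim (<-irrefl refl h)
ratio-eq m (suc k) h = ratio-mul m k

ratio-pos : ∀ m n → 0ℚ < ratio m n → (0ℚ < toℚ m) × (0ℚ < toℚ n)
ratio-pos m zero h = ⊥-elim (<-irrefl refl h)
ratio-pos m (suc k) h = subst (0ℚ <_) (ratio-mul m k) (*-pos h (toℚ-suc-pos k)) , toℚ-suc-pos k

ratio≤1 : ∀ m n → toℚ m ≤ toℚ n → ratio m n ≤ 1ℚ
ratio≤1 m zero h = nonNegative⁻¹ 1ℚ
ratio≤1 m (suc k) h = cancelʳ (toℚ (suc k)) (toℚ-suc-pos k)
  (subst₂ _≤_ (sym (ratio-mul m k)) (sym (*-identityˡ _)) h)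

ratio-± : ∀ m n c e → 0ℚ < toℚ n → ratio m n ≈ c ± e →
  ((c - e) * toℚ n ≤ toℚ m) × (toℚ m ≤ (c + e) * toℚ n)
ratio-± m n c e h (lo , hi) =
  subst ((c - e) * toℚ n ≤_) (ratio-eq m n h) (mulʳ (toℚ n) (<⇒≤ h) lo) ,
  subst (_≤ (c + e) * toℚ n) (ratio-eq m n h) (mulʳ (toℚ n) (<⇒≤ h) hi)

sumQ : ∀ {n} → (Fin n → ℚ) → ℚ
sumQ {zero} f = 0ℚ
sumQ {suc n} f = f F.zero + sumQ (λ i → f (F.suc i))

sumQ-mono : ∀ {n} {f g : Fin n → ℚ} → (∀ i → f i ≤ g i) → sumQ f ≤ sumQ g
sumQ-mono {zero} h = ≤-refl
sumQ-mono {suc n} h = +-mono-≤ (h F.zero) (sumQ-mono (λ i → h (F.suc i)))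

sumQ-+ : ∀ {n} (f g : Fin n → ℚ) → sumQ (λ i → f i + g i) ≡ sumQ f + sumQ g
sumQ-+ {zero} f g = refl
sumQ-+ {suc n} f g rewrite sumQ-+ (λ i → f (F.suc i)) (λ i → g (F.suc i)) =
  solve 4 (λ a b c d → (a :+ b) :+ (c :+ d) := (a :+ c) :+ (b :+ d)) refl (f F.zero) (g F.zero) _ _

sumQ-* : ∀ {n} (c : ℚ) (f : Fin n → ℚ) → sumQ (λ i → c * f i) ≡ c * sumQ f
sumQ-* {zero} c f = sym (*-zeroʳ c)
sumQ-* {suc n} c f rewrite sumQ-* c (λ i → f (F.suc i)) = sym (*-distribˡ-+ c (f F.zero) _)

sumQ-cong : ∀ {n} {f g : Fin n → ℚ} → (∀ i → f i ≡ g i) → sumQ f ≡ sumQ g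
sumQ-cong {zero} h = refl
sumQ-cong {suc n} h = cong₂ _+_ (h F.zero) (sumQ-cong (λ i → h (F.suc i)))

sel : Bool → ℚ → ℚ
sel b x = if b then x else 0ℚ

ind : Bool → ℚ
ind b = sel b 1ℚ

sel-ind : ∀ b x → sel b x ≡ x * ind b
sel-ind true x = sym (*-identityʳ x)
sel-ind false x = sym (*-zeroʳ x)

ind-nonneg : ∀ b → NonNeg (ind b)
ind-nonneg true = frac-nonneg 1 1
ind-nonneg false = ≤-refl

sumQ-sel : ∀ {n} b (f : Fin n → ℚ) → sel b (sumQ f) ≡ sumQ (λ i → sel b (f i))
sumQ-sel b f = trans (sel-ind b (sumQ f)) (trans (*-comm (sumQ f) (ind b))
  (trans (sym (sumQ-* (ind b) f)) (sumQ-cong (λ i → trans (*-comm (ind b) (f i)) (sym (sel-ind b (f i)))))))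

count-toℚ : ∀ {n} (P : Fin n → Bool) → toℚ (count P) ≡ sumQ (λ i → ind (P i))
count-toℚ {zero} P = refl
count-toℚ {suc n} P with P F.zero
... | true = trans (toℚ-+ 1 (count (λ i → P (F.suc i)))) (cong (λ x → 1ℚ + x) (count-toℚ (λ i → P (F.suc i))))
... | false = trans (toℚ-+ 0 (count (λ i → P (F.suc i)))) (cong (λ x → 0ℚ + x) (count-toℚ (λ i → P (F.suc i))))

count2-toℚ : ∀ {m n} (P : Fin m → Fin n → Bool) → toℚ (count2 P) ≡ sumQ (λ a → toℚ (count (P a)))
count2-toℚ {zero} P = refl
count2-toℚ {suc m} P = trans (toℚ-+ (count (P F.zero)) _) (cong (λ x → toℚ (count (P F.zero)) + x) (count2-toℚ (λ i → P (F.suc i))))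

count3-toℚ : ∀ {l m n} (P : Fin l → Fin m → Fin n → Bool) → toℚ (count3 P) ≡ sumQ (λ a → toℚ (count2 (P a)))
count3-toℚ {zero} P = refl
count3-toℚ {suc l} P = trans (toℚ-+ (count2 (P F.zero)) _) (cong (λ x → toℚ (count2 (P F.zero)) + x) (count3-toℚ (λ i → P (F.suc i))))

count-cong : ∀ {n} {P Q : Fin n → Bool} → (∀ i → P i ≡ Q i) → count P ≡ count Q
count-cong {zero} h = refl
count-cong {suc n} {P} {Q} h rewrite h F.zero = cong ((if Q F.zero then 1 else 0) ℕ.+_) (count-cong (λ i → h (F.suc i)))

count2-cong : ∀ {m n} {P Q : Fin m → Fin n → Bool} → (∀ i j → P i j ≡ Q i j) → count2 P ≡ count2 Q
count2-cong {zero} h = refl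
count2-cong {suc m} h = cong₂ ℕ._+_ (count-cong (h F.zero)) (count2-cong (λ i → h (F.suc i)))

count3-cong : ∀ {l m n} {P Q : Fin l → Fin m → Fin n → Bool} → (∀ i j k → P i j k ≡ Q i j k) → count3 P ≡ count3 Q
count3-cong {zero} h = refl
count3-cong {suc l} h = cong₂ ℕ._+_ (count2-cong (h F.zero)) (count3-cong (λ i → h (F.suc i)))

count-sel : ∀ {n} (b : Bool) (P : Fin n → Bool) → toℚ (count (λ i → b ∧ P i)) ≡ sel b (toℚ (count P))
count-sel true P = refl
count-sel {n} false P = cong toℚ (vanish n)
  where
  vanish : ∀ n → count {n} (λ _ → false) ≡ 0
  vanish zero = refl
  vanish (suc n) = vanish n

count2-sel : ∀ {m n} (b : Bool) (P : Fin m → Fin n → Bool) → toℚ (count2 (λ i j → b ∧ P i j)) ≡ sel b (toℚ (count2 P))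
count2-sel b P = begin
  toℚ (count2 (λ i j → b ∧ P i j))       ≡⟨ count2-toℚ (λ i j → b ∧ P i j) ⟩
  sumQ (λ i → toℚ (count (λ j → b ∧ P i j))) ≡⟨ sumQ-cong (λ i → count-sel b (P i)) ⟩
  sumQ (λ i → sel b (toℚ (count (P i))))  ≡⟨ sym (sumQ-sel b (λ i → toℚ (count (P i)))) ⟩
  sel b (sumQ (λ i → toℚ (count (P i))))  ≡⟨ cong (sel b) (sym (count2-toℚ P)) ⟩
  sel b (toℚ (count2 P))                  ∎
  where open ≡-Reasoning

count2-prod : ∀ {m n} (p : Fin m → Bool) (q : Fin n → Bool) →
  toℚ (count2 (λ i j → p i ∧ q j)) ≡ toℚ (count p) * toℚ (count q)
count2-prod p q = begin
  toℚ (count2 (λ i j → p i ∧ q j))             ≡⟨ count2-toℚ (λ i j → p i ∧ q j) ⟩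
  sumQ (λ i → toℚ (count (λ j → p i ∧ q j)))  ≡⟨ sumQ-cong (λ i → trans (count-sel (p i) q) (sel-ind (p i) _)) ⟩
  sumQ (λ i → toℚ (count q) * ind (p i))       ≡⟨ sumQ-* (toℚ (count q)) (λ i → ind (p i)) ⟩
  toℚ (count q) * sumQ (λ i → ind (p i))       ≡⟨ cong (toℚ (count q) *_) (sym (count-toℚ p)) ⟩
  toℚ (count q) * toℚ (count p)                ≡⟨ *-comm (toℚ (count q)) (toℚ (count p)) ⟩
  toℚ (count p) * toℚ (count q)                ∎
  where open ≡-Reasoning

ind-mono : ∀ a b → (T a → T b) → ind a ≤ ind b
ind-mono false b h = ind-nonneg b
ind-mono true false h = ⊥-elim (h tt)
ind-mono true true h = ≤-refl

count-mono : ∀ {n} (P Q : Fin n → Bool) → (∀ i → T (P i) → T (Q i)) → toℚ (count P) ≤ toℚ (count Q)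
count-mono P Q h = subst₂ _≤_ (sym (count-toℚ P)) (sym (count-toℚ Q)) (sumQ-mono (λ i → ind-mono (P i) (Q i) (h i)))

count2-mono : ∀ {m n} (P Q : Fin m → Fin n → Bool) → (∀ i j → T (P i j) → T (Q i j)) → toℚ (count2 P) ≤ toℚ (count2 Q)
count2-mono P Q h = subst₂ _≤_ (sym (count2-toℚ P)) (sym (count2-toℚ Q)) (sumQ-mono (λ i → count-mono (P i) (Q i) (h i)))

count3-mono : ∀ {l m n} (P Q : Fin l → Fin m → Fin n → Bool) → (∀ i j k → T (P i j k) → T (Q i j k)) → toℚ (count3 P) ≤ toℚ (count3 Q)
count3-mono P Q h = subst₂ _≤_ (sym (count3-toℚ P)) (sym (count3-toℚ Q)) (sumQ-mono (λ i → count2-mono (P i) (Q i) (h i)))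

≤⇒≯ : ∀ {a b} → a ≤ b → ¬ (b < a)
≤⇒≯ h g = <-irrefl refl (≤-<-trans h g)

∧-intro : ∀ {a b} → T a → T b → T (a ∧ b)
∧-intro {true} {true} _ _ = tt

∧-fst : ∀ {a b} → T (a ∧ b) → T a
∧-fst {a} {b} h = proj₁ (Equivalence.to (T-∧ {a} {b}) h)

∧-snd : ∀ {a b} → T (a ∧ b) → T b
∧-snd {a} {b} h = proj₂ (Equivalence.to (T-∧ {a} {b}) h)

failed-test : ∀ {P : Set} (d : Dec P) → T (not ⌊ d ⌋) → ¬ P
failed-test (yes p) ()
failed-test (no ¬p) _ = ¬p

ind-split : ∀ a b → (T b → T a) → ind a ≡ ind b + ind (a ∧ not b)
ind-split true true h = refl
ind-split true false h = refl
ind-split false true h = ⊥-elim (h tt)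
ind-split false false h = refl

ind-chain : ∀ a b c → ind (a ∧ not (b ∧ c)) ≤ ind (a ∧ not b) + ind (b ∧ not c)
ind-chain false b c = +-nonneg (ind-nonneg false) (ind-nonneg (b ∧ not c))
ind-chain true false c = ≤-reflexive (sym (+-identityʳ 1ℚ))
ind-chain true true c = ≤-reflexive (sym (+-identityˡ (ind (not c))))

ind-∧-not : ∀ a p q → ind (a ∧ not (p ∧ q)) ≤ ind (a ∧ not p) + ind (a ∧ not q)
ind-∧-not false p q = ≤-refl
ind-∧-not true false q = +-monoʳ-≤ 1ℚ (ind-nonneg (not q))
ind-∧-not true true q = ≤-reflexive (sym (+-identityˡ (ind (not q))))

∧-not-guarded : ∀ a c → (a ∧ not (a ∧ c)) ≡ (a ∧ not c)
∧-not-guarded true c = refl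
∧-not-guarded false c = refl

-- It is instantiated by sums over Fin n (vertices) and over
-- Fin m × Fin n (pairs), so that parts (i) and (ii) share one argument.
record Summation (I : Set) : Set₁ where
  field
    S : (I → ℚ) → ℚ
    S-mono : ∀ {f g} → (∀ x → f x ≤ g x) → S f ≤ S g
    S-+ : ∀ f g → S (λ x → f x + g x) ≡ S f + S g
    S-* : ∀ c f → S (λ x → c * f x) ≡ c * S f

vertexSum : ∀ n → Summation (Fin n)
vertexSum n = record { S = sumQ ; S-mono = sumQ-mono ; S-+ = sumQ-+ ; S-* = sumQ-* }

pairSum : ∀ m n → Summation (Fin m × Fin n)
pairSum m n = record
  { S = λ f → sumQ (λ a → sumQ (λ b → f (a , b)))
  ; S-mono = λ h → sumQ-mono (λ a → sumQ-mono (λ b → h (a , b)))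
  ; S-+ = λ f g → trans (sumQ-cong (λ a → sumQ-+ (λ b → f (a , b)) (λ b → g (a , b))))
                        (sumQ-+ (λ a → sumQ (λ b → f (a , b))) (λ a → sumQ (λ b → g (a , b))))
  ; S-* = λ c f → trans (sumQ-cong (λ a → sumQ-* c (λ b → f (a , b))))
                        (sumQ-* c (λ a → sumQ (λ b → f (a , b))))
  }

third : ℚ
third = + 1 / 3

-- The numerical conditions of the concentration lemma (Sums.Concentration
-- below): sets of more than ε'N/3 typical elements carry more than an
-- ε-fraction of the weight, the window (1 ± ε')r strictly contains the
-- averages [(D-ε)L, (D+ε)W] possible on them, and η ≤ ε'/3.
record Thresholds (ε η L W D ε' : ℚ) : Set where
  field
    ε'-nonneg : NonNeg ε'
    ε'≤1 : ε' ≤ 1ℚ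
    regular-threshold : ε * W ≤ (third * ε') * L
    upper-gap : (D + ε) * W < (1ℚ + ε') * (1ℚ - η) * D * L
    lower-gap : (1ℚ - ε') * D * W < (D - ε) * L
    few-atypical : η ≤ third * ε'

module Sums {I : Set} (Σᴵ : Summation I) where
  open Summation Σᴵ public

  S-cong : ∀ {f g} → (∀ x → f x ≡ g x) → S f ≡ S g
  S-cong h = ≤-antisym (S-mono (λ x → ≤-reflexive (h x))) (S-mono (λ x → ≤-reflexive (sym (h x))))

  _⊆_ : (I → Bool) → (I → Bool) → Set
  A ⊆ B = ∀ x → T (A x) → T (B x)

  cnt : (I → Bool) → ℚ
  cnt B = S (λ x → ind (B x))

  S[_] : (I → Bool) → (I → ℚ) → ℚ
  S[ B ] f = S (λ x → sel (B x) (f x))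

  S-lower : ∀ (B : I → Bool) f c → (∀ x → T (B x) → c ≤ f x) → c * cnt B ≤ S[ B ] f
  S-lower B f c h = subst (_≤ S[ B ] f) (S-* c (λ x → ind (B x))) (S-mono (λ x → bound (B x) (h x)))
    where
    bound : ∀ b {y} → (T b → c ≤ y) → c * ind b ≤ sel b y
    bound true h = subst (_≤ _) (sym (*-identityʳ c)) (h tt)
    bound false h = ≤-reflexive (*-zeroʳ c)

  S-upper : ∀ (B : I → Bool) f c → (∀ x → T (B x) → f x ≤ c) → S[ B ] f ≤ c * cnt B
  S-upper B f c h = subst (S[ B ] f ≤_) (S-* c (λ x → ind (B x))) (S-mono (λ x → bound (B x) (h x)))
    where
    bound : ∀ b {y} → (T b → y ≤ c) → sel b y ≤ c * ind b
    bound true h = subst (_ ≤_) (sym (*-identityʳ c)) (h tt)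
    bound false h = ≤-reflexive (sym (*-zeroʳ c))

  S[]≤S : ∀ (B : I → Bool) f → (∀ x → NonNeg (f x)) → S[ B ] f ≤ S f
  S[]≤S B f h = S-mono (λ x → bound (B x) (h x))
    where
    bound : ∀ b {y} → NonNeg y → sel b y ≤ y
    bound true h = ≤-refl
    bound false h = h

  cnt-nonneg : ∀ (B : I → Bool) → NonNeg (cnt B)
  cnt-nonneg B = subst (_≤ cnt B) S-zero (S-mono (λ x → ind-nonneg (B x)))
    where
    S-zero : S (λ _ → 0ℚ) ≡ 0ℚ
    S-zero = trans (S-cong (λ _ → sym (*-zeroˡ 0ℚ))) (trans (S-* 0ℚ (λ _ → 0ℚ)) (*-zeroˡ (S (λ _ → 0ℚ))))

  cnt-mono : ∀ (A B : I → Bool) → A ⊆ B → cnt A ≤ cnt B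
  cnt-mono A B h = S-mono (λ x → ind-mono (A x) (B x) (h x))

  cnt-chain : ∀ (A B C : I → Bool) → cnt (λ x → A x ∧ not (B x ∧ C x)) ≤ cnt (λ x → A x ∧ not (B x)) + cnt (λ x → B x ∧ not (C x))
  cnt-chain A B C = ≤-trans (S-mono (λ x → ind-chain (A x) (B x) (C x)))
    (≤-reflexive (S-+ (λ x → ind (A x ∧ not (B x))) (λ x → ind (B x ∧ not (C x)))))

  cnt-∧-not : ∀ (A P Q : I → Bool) → cnt (λ x → A x ∧ not (P x ∧ Q x)) ≤ cnt (λ x → A x ∧ not (P x)) + cnt (λ x → A x ∧ not (Q x))
  cnt-∧-not A P Q = ≤-trans (S-mono (λ x → ind-∧-not (A x) (P x) (Q x)))
    (≤-reflexive (S-+ (λ x → ind (A x ∧ not (P x))) (λ x → ind (A x ∧ not (Q x)))))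

  total-weight : ∀ (X Tp : I → Bool) (weight : I → ℚ) (U M N η : ℚ) → Tp ⊆ X → NonNeg U → NonNeg M →
    (∀ x → weight x ≤ sel (X x) M) → (∀ x → T (Tp x) → weight x ≤ U) →
    cnt X ≡ N → cnt (λ x → X x ∧ not (Tp x)) ≤ η * N →
    S weight ≤ N * (U + η * M)
  total-weight X Tp weight U M N η Tp⊆X U0 M0 bounded typical size atypical = begin
    S weight ≤⟨ S-mono (λ x → split (Tp x) (X x) (Tp⊆X x) (typical x) (bounded x)) ⟩
    S (λ x → sel (Tp x) U + sel (X x ∧ not (Tp x)) M)
      ≡⟨ S-+ (λ x → sel (Tp x) U) (λ x → sel (X x ∧ not (Tp x)) M) ⟩
    S[ Tp ] (λ _ → U) + S[ (λ x → X x ∧ not (Tp x)) ] (λ _ → M)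
      ≤⟨ +-mono-≤ (S-upper Tp (λ _ → U) U (λ _ _ → ≤-refl)) (S-upper (λ x → X x ∧ not (Tp x)) (λ _ → M) M (λ _ _ → ≤-refl)) ⟩
    U * cnt Tp + M * cnt (λ x → X x ∧ not (Tp x))
      ≤⟨ +-mono-≤ (mulˡ U U0 (subst (cnt Tp ≤_) size (cnt-mono Tp X Tp⊆X))) (mulˡ M M0 atypical) ⟩
    U * N + M * (η * N) ≡⟨ solve 4 (λ U M N η → U :* N :+ M :* (η :* N) := N :* (U :+ η :* M)) refl U M N η ⟩
    N * (U + η * M) ∎
    where
    open ≤-Reasoning
    split : ∀ t x {w} → (T t → T x) → (T t → w ≤ U) → w ≤ sel x M → w ≤ sel t U + sel (x ∧ not t) M
    split true true t⇒x w≤U w≤M = subst (_ ≤_) (sym (+-identityʳ U)) (w≤U tt)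
    split true false t⇒x w≤U w≤M = ⊥-elim (t⇒x tt)
    split false true t⇒x w≤U w≤M = subst (_ ≤_) (sym (+-identityˡ M)) w≤M
    split false false t⇒x w≤U w≤M = w≤M

  within : (I → ℚ) → ℚ → ℚ → I → Bool
  within f lo hi x = ⌊ f x ≤? hi ⌋ ∧ ⌊ lo ≤? f x ⌋

  within-bounds : ∀ f lo hi x → T (within f lo hi x) → (lo ≤ f x) × (f x ≤ hi)
  within-bounds f lo hi x w =
    toWitness {a? = lo ≤? f x} (∧-snd {⌊ f x ≤? hi ⌋} w) , toWitness {a? = f x ≤? hi} (∧-fst {⌊ f x ≤? hi ⌋} w)

  -- Suppose every subset B ⊆ Y with more than θ elements
  -- has average of f at most κ (at least κ).  Then the elements of Y with
  -- f above t > κ (below t < κ) form such a subset whose average exceeds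
  -- t (falls below t), so there are at most θ of them.

  few-above : ∀ (Y : I → Bool) f θ κ t → NonNeg θ → κ < t →
    (∀ B → B ⊆ Y → θ < cnt B → S[ B ] f ≤ κ * cnt B) →
    cnt (λ x → Y x ∧ not ⌊ f x ≤? t ⌋) ≤ θ
  few-above Y f θ κ t θ0 κ<t average = ≮⇒≥ impossible
    where
    H : I → Bool
    H x = Y x ∧ not ⌊ f x ≤? t ⌋
    impossible : θ < cnt H → ⊥
    impossible big = ≤⇒≯ (cancelʳ (cnt H) (≤-<-trans θ0 big) (begin
      t * cnt H ≤⟨ S-lower H f t (λ x h → <⇒≤ (≰⇒> (failed-test (f x ≤? t) (∧-snd {Y x} h)))) ⟩
      S[ H ] f  ≤⟨ average H (λ x h → ∧-fst h) big ⟩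
      κ * cnt H ∎)) κ<t
      where open ≤-Reasoning

  few-below : ∀ (Y : I → Bool) f θ κ t → NonNeg θ → t < κ →
    (∀ B → B ⊆ Y → θ < cnt B → κ * cnt B ≤ S[ B ] f) →
    cnt (λ x → Y x ∧ not ⌊ t ≤? f x ⌋) ≤ θ
  few-below Y f θ κ t θ0 t<κ average = ≮⇒≥ impossible
    where
    H : I → Bool
    H x = Y x ∧ not ⌊ t ≤? f x ⌋
    impossible : θ < cnt H → ⊥
    impossible big = ≤⇒≯ (cancelʳ (cnt H) (≤-<-trans θ0 big) (begin
      κ * cnt H ≤⟨ average H (λ x h → ∧-fst h) big ⟩
      S[ H ] f  ≤⟨ S-upper H f t (λ x h → <⇒≤ (≰⇒> (failed-test (t ≤? f x) (∧-snd {Y x} h)))) ⟩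
      t * cnt H ∎)) t<κ
      where open ≤-Reasoning

  few-outside : ∀ (Y : I → Bool) f θ κ₋ κ₊ t₋ t₊ → NonNeg θ → t₋ < κ₋ → κ₊ < t₊ →
    (∀ B → B ⊆ Y → θ < cnt B → (κ₋ * cnt B ≤ S[ B ] f) × (S[ B ] f ≤ κ₊ * cnt B)) →
    cnt (λ x → Y x ∧ not (within f t₋ t₊ x)) ≤ θ + θ
  few-outside Y f θ κ₋ κ₊ t₋ t₊ θ0 t₋<κ₋ κ₊<t₊ average =
    ≤-trans (cnt-∧-not Y (λ x → ⌊ f x ≤? t₊ ⌋) (λ x → ⌊ t₋ ≤? f x ⌋))
            (+-mono-≤ (few-above Y f θ κ₊ t₊ θ0 κ₊<t₊ (λ B B⊆Y big → proj₂ (average B B⊆Y big)))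
                      (few-below Y f θ κ₋ t₋ θ0 t₋<κ₋ (λ B B⊆Y big → proj₁ (average B B⊆Y big))))

  -- Elements x of X carry a weight (the size of the "star" of x) and a
  -- link (the part of the star lying in G_123); on average the link is a
  -- D-fraction of the weight, also on every subset carrying more than an
  -- ε-fraction of the total weight (this is what triple regularity gives).
  record WeightedSystem : Set where
    field
      X Tp : I → Bool
      Tp⊆X : Tp ⊆ X
      weight link : I → ℚ
      N L W D r ε η : ℚ
      N-pos : 0ℚ < N
      L-pos : 0ℚ < L
      ε-nonneg : NonNeg ε
      D-ε-nonneg : NonNeg (D - ε)
      size : cnt X ≡ N
      atypical : cnt (λ x → X x ∧ not (Tp x)) ≤ η * N
      weight-nonneg : ∀ x → NonNeg (weight x)
      weight-typical : ∀ x → T (Tp x) → (L ≤ weight x) × (weight x ≤ W)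
      weight-total : S weight ≤ N * W
      link-total : S link ≡ D * S weight
      mean : r * N ≡ S link
      regular : ∀ B → ε * S weight < S[ B ] weight →
        ((D - ε) * S[ B ] weight ≤ S[ B ] link) × (S[ B ] link ≤ (D + ε) * S[ B ] weight)

  module Concentration (C : WeightedSystem) (ε' : ℚ)
    (B : Thresholds (WeightedSystem.ε C) (WeightedSystem.η C) (WeightedSystem.L C)
                    (WeightedSystem.W C) (WeightedSystem.D C) ε') where
    open WeightedSystem C
    open Thresholds B
    open ≤-Reasoning

    D-nonneg : NonNeg D
    D-nonneg = subst NonNeg (solve 2 (λ D ε → (D :- ε) :+ ε := D) refl D ε) (+-nonneg D-ε-nonneg ε-nonneg)

    θ : ℚ
    θ = (third * ε') * N

    θ-nonneg : NonNeg θ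
    θ-nonneg = *-nonneg (*-nonneg (frac-nonneg 1 3) ε'-nonneg) (<⇒≤ N-pos)

    typical-count : N - η * N ≤ cnt Tp
    typical-count = begin
      N - η * N                                 ≡⟨ cong (_- η * N) (sym size) ⟩
      cnt X - η * N                             ≤⟨ +-monoʳ-≤ (cnt X) (neg-antimono-≤ atypical) ⟩
      cnt X - cnt (λ x → X x ∧ not (Tp x))      ≡⟨ cong (_- cnt (λ x → X x ∧ not (Tp x))) split ⟩
      cnt Tp + cnt (λ x → X x ∧ not (Tp x)) - cnt (λ x → X x ∧ not (Tp x))
                                                ≡⟨ solve 2 (λ a b → a :+ b :- b := a) refl (cnt Tp) _ ⟩
      cnt Tp                                    ∎
      where
      split : cnt X ≡ cnt Tp + cnt (λ x → X x ∧ not (Tp x))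
      split = trans (S-cong (λ x → ind-split (X x) (Tp x) (Tp⊆X x)))
                    (S-+ (λ x → ind (Tp x)) (λ x → ind (X x ∧ not (Tp x))))

    r-lower : (1ℚ - η) * D * L ≤ r
    r-lower = cancelʳ N N-pos (begin
      (1ℚ - η) * D * L * N ≡⟨ solve 4 (λ η D L N → (con 1ℚ :- η) :* D :* L :* N := D :* (L :* (N :- η :* N))) refl η D L N ⟩
      D * (L * (N - η * N)) ≤⟨ mulˡ D D-nonneg (≤-trans (mulˡ L (<⇒≤ L-pos) typical-count)
                                 (≤-trans (S-lower Tp weight L (λ x t → proj₁ (weight-typical x t)))
                                          (S[]≤S Tp weight weight-nonneg))) ⟩
      D * S weight ≡⟨ sym (trans mean link-total) ⟩
      r * N ∎)

    r-upper : r ≤ D * W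
    r-upper = cancelʳ N N-pos (begin
      r * N        ≡⟨ trans mean link-total ⟩
      D * S weight ≤⟨ mulˡ D D-nonneg weight-total ⟩
      D * (N * W)  ≡⟨ solve 3 (λ D N W → D :* (N :* W) := D :* W :* N) refl D N W ⟩
      D * W * N    ∎)

    big-is-regular : ∀ B → B ⊆ Tp → θ < cnt B → ε * S weight < S[ B ] weight
    big-is-regular B B⊆Tp big = ≤-<-trans (begin
      ε * S weight ≤⟨ mulˡ ε ε-nonneg weight-total ⟩
      ε * (N * W)  ≡⟨ solve 3 (λ ε N W → ε :* (N :* W) := N :* (ε :* W)) refl ε N W ⟩
      N * (ε * W)  ≤⟨ mulˡ N (<⇒≤ N-pos) regular-threshold ⟩
      N * ((third * ε') * L) ≡⟨ solve 4 (λ N c e L → N :* ((c :* e) :* L) := L :* ((c :* e) :* N)) refl N third ε' L ⟩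
      L * θ ∎)
      (<-≤-trans (*-monoʳ-<-pos L {{positive L-pos}} big)
                 (S-lower B weight L (λ x t → proj₁ (weight-typical x (B⊆Tp x t)))))

    average-on-big : ∀ B → B ⊆ Tp → θ < cnt B →
      ((D - ε) * L * cnt B ≤ S[ B ] link) × (S[ B ] link ≤ (D + ε) * W * cnt B)
    average-on-big B B⊆Tp big = lower , upper
      where
      reg = regular B (big-is-regular B B⊆Tp big)
      D+ε-nonneg : NonNeg (D + ε)
      D+ε-nonneg = +-nonneg D-nonneg ε-nonneg
      lower = begin
        (D - ε) * L * cnt B   ≡⟨ *-assoc (D - ε) L (cnt B) ⟩
        (D - ε) * (L * cnt B) ≤⟨ mulˡ (D - ε) D-ε-nonneg (S-lower B weight L (λ x t → proj₁ (weight-typical x (B⊆Tp x t)))) ⟩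
        (D - ε) * S[ B ] weight ≤⟨ proj₁ reg ⟩
        S[ B ] link ∎
      upper = begin
        S[ B ] link ≤⟨ proj₂ reg ⟩
        (D + ε) * S[ B ] weight ≤⟨ mulˡ (D + ε) D+ε-nonneg (S-upper B weight W (λ x t → proj₂ (weight-typical x (B⊆Tp x t)))) ⟩
        (D + ε) * (W * cnt B) ≡⟨ sym (*-assoc (D + ε) W (cnt B)) ⟩
        (D + ε) * W * cnt B ∎

    window-lower : r - ε' * r < (D - ε) * L
    window-lower = ≤-<-trans (begin
      r - ε' * r       ≡⟨ solve 2 (λ r e → r :- e :* r := (con 1ℚ :- e) :* r) refl r ε' ⟩
      (1ℚ - ε') * r    ≤⟨ mulˡ (1ℚ - ε') (≤⇒diff ε'≤1) r-upper ⟩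
      (1ℚ - ε') * (D * W) ≡⟨ sym (*-assoc (1ℚ - ε') D W) ⟩
      (1ℚ - ε') * D * W ∎) lower-gap

    window-upper : (D + ε) * W < r + ε' * r
    window-upper = <-≤-trans upper-gap (begin
      (1ℚ + ε') * (1ℚ - η) * D * L   ≡⟨ solve 4 (λ e η D L → (con 1ℚ :+ e) :* (con 1ℚ :- η) :* D :* L := (con 1ℚ :+ e) :* ((con 1ℚ :- η) :* D :* L)) refl ε' η D L ⟩
      (1ℚ + ε') * ((1ℚ - η) * D * L) ≤⟨ mulˡ (1ℚ + ε') (+-nonneg (nonNegative⁻¹ 1ℚ) ε'-nonneg) r-lower ⟩
      (1ℚ + ε') * r                  ≡⟨ solve 2 (λ e r → (con 1ℚ :+ e) :* r := r :+ e :* r) refl ε' r ⟩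
      r + ε' * r ∎)

    good bad : I → Bool
    good x = Tp x ∧ within link (r - ε' * r) (r + ε' * r) x
    bad x = X x ∧ not (good x)

    -- Bad elements are atypical (at most ηN ≤ ε'N/3) or typical with link
    -- outside the window (at most 2θ by the outlier lemmas).
    few-bad : cnt bad ≤ ε' * N
    few-bad = begin
      cnt bad ≤⟨ cnt-chain X Tp (within link (r - ε' * r) (r + ε' * r)) ⟩
      cnt (λ x → X x ∧ not (Tp x)) + cnt (λ x → Tp x ∧ not (within link (r - ε' * r) (r + ε' * r) x))
        ≤⟨ +-mono-≤ atypical (few-outside Tp link θ ((D - ε) * L) ((D + ε) * W) (r - ε' * r) (r + ε' * r)
                                θ-nonneg window-lower window-upper average-on-big) ⟩
      η * N + (θ + θ) ≤⟨ +-monoˡ-≤ (θ + θ) (mulʳ N (<⇒≤ N-pos) few-atypical) ⟩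
      θ + (θ + θ)     ≡⟨ solve 2 (λ e N → (con third :* e) :* N :+ ((con third :* e) :* N :+ (con third :* e) :* N) := e :* N) refl ε' N ⟩
      ε' * N ∎

    good-in-window : ∀ x → T (X x) → ¬ T (bad x) → link x ≈ r ± (ε' * r)
    good-in-window x x∈X x∉bad with good x in eq
    ... | true = within-bounds link (r - ε' * r) (r + ε' * r) x (∧-snd {Tp x} g)
      where
      g : T (good x)
      g = subst T (sym eq) tt
    ... | false = ⊥-elim (x∉bad (∧-intro x∈X tt))

    concentration : Σ (I → Bool) λ Bad → (cnt Bad ≤ ε' * N) ×
      (∀ x → T (X x) → ¬ T (Bad x) → link x ≈ r ± (ε' * r))
    concentration = bad , few-bad , good-in-window

module PairCounts {m n : ℕ} where
  open Sums (pairSum m n)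

  cnt-pairs : ∀ (Q : Fin m → Fin n → Bool) → cnt (λ p → Q (proj₁ p) (proj₂ p)) ≡ toℚ (count2 Q)
  cnt-pairs Q = trans (sumQ-cong (λ u → sym (count-toℚ (Q u)))) (sym (count2-toℚ Q))

  cnt-fibred : ∀ (A : Fin m → Bool) (Q : Fin m → Fin n → Bool) →
    cnt (λ p → A (proj₁ p) ∧ Q (proj₁ p) (proj₂ p)) ≡ sumQ (λ u → sel (A u) (toℚ (count (Q u))))
  cnt-fibred A Q = sumQ-cong (λ u → trans (sym (count-toℚ (λ v → A u ∧ Q u v))) (count-sel (A u) (Q u)))

module PairRegularity {m n : ℕ} (ε : ℚ) (ε-pos : 0ℚ < ε)
  (Gi : Fin m → Bool) (Gj : Fin n → Bool) (Gij : Fin m → Fin n → Bool)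
  (reg : pairRegular ε Gi Gj Gij) where

  δ : ℚ
  δ = ratio (count2 Gij) (count2 (λ a b → Gi a ∧ Gj b))

  big⇒pos : ∀ {k l : ℕ} → ε * toℚ k < toℚ l → 0ℚ < toℚ l
  big⇒pos {k} h = ≤-<-trans (*-nonneg (<⇒≤ ε-pos) (toℚ-nonneg k)) h

  edges : (Fin m → Bool) → (Fin n → Bool) → ℚ
  edges A B = toℚ (count2 (λ a b → A a ∧ B b ∧ Gij a b))

  edges-between : ∀ A B → A ⊆₁ Gi → B ⊆₁ Gj →
    ε * toℚ (count Gi) < toℚ (count A) → ε * toℚ (count Gj) < toℚ (count B) →
    ((δ - ε) * (toℚ (count A) * toℚ (count B)) ≤ edges A B) × (edges A B ≤ (δ + ε) * (toℚ (count A) * toℚ (count B)))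
  edges-between A B A⊆Gi B⊆Gj A-big B-big =
    subst (λ z → (δ - ε) * z ≤ edges A B) (toℚ-* (count A) (count B)) (proj₁ bounds) ,
    subst (λ z → edges A B ≤ (δ + ε) * z) (toℚ-* (count A) (count B)) (proj₂ bounds)
    where
    size-pos : 0ℚ < toℚ (count A ℕ.* count B)
    size-pos = subst (0ℚ <_) (sym (toℚ-* (count A) (count B)))
                (*-pos (big⇒pos {count Gi} {count A} A-big) (big⇒pos {count Gj} {count B} B-big))
    bounds = ratio-± _ (count A ℕ.* count B) δ ε size-pos (reg A B A⊆Gi B⊆Gj A-big B-big)

  open Sums (vertexSum m)

  deg : (Fin n → Bool) → Fin m → ℚ
  deg B a = toℚ (count (λ b → B b ∧ Gij a b))

  typical : (Fin n → Bool) → Fin m → Bool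
  typical B = within (deg B) ((δ - (ε + ε)) * toℚ (count B)) ((δ + (ε + ε)) * toℚ (count B))

  edges≡S[] : ∀ A B → edges A B ≡ S[ A ] (deg B)
  edges≡S[] A B = trans (count2-toℚ (λ a b → A a ∧ B b ∧ Gij a b))
                        (sumQ-cong (λ a → count-sel (A a) (λ b → B b ∧ Gij a b)))

  -- On big sets A ⊆ Gi the average degree into B is
  -- (δ ± ε)|B| by regularity, so the outlier lemmas apply.
  few-atypical : ∀ B → B ⊆₁ Gj → ε * toℚ (count Gj) < toℚ (count B) →
    cnt (λ a → Gi a ∧ not (typical B a)) ≤ ε * cnt Gi + ε * cnt Gi
  few-atypical B B⊆Gj B-big = few-outside Gi (deg B) (ε * cnt Gi) ((δ - ε) * nB) ((δ + ε) * nB)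
    ((δ - (ε + ε)) * nB) ((δ + (ε + ε)) * nB)
    (*-nonneg (<⇒≤ ε-pos) (cnt-nonneg Gi))
    (cert< _ (solve 3 (λ δ ε b → (δ :- ε) :* b :- (δ :- (ε :+ ε)) :* b := ε :* b) refl δ ε nB) εnB-pos)
    (cert< _ (solve 3 (λ δ ε b → (δ :+ (ε :+ ε)) :* b :- (δ :+ ε) :* b := ε :* b) refl δ ε nB) εnB-pos)
    average
    where
    nB : ℚ
    nB = toℚ (count B)
    εnB-pos : 0ℚ < ε * nB
    εnB-pos = *-pos ε-pos (big⇒pos {count Gj} {count B} B-big)
    average : ∀ A → A ⊆ Gi → ε * cnt Gi < cnt A →
      ((δ - ε) * nB * cnt A ≤ S[ A ] (deg B)) × (S[ A ] (deg B) ≤ (δ + ε) * nB * cnt A)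
    average A A⊆Gi A-big =
      subst₂ _≤_ (rearrange (δ - ε)) (edges≡S[] A B) (proj₁ bounds) ,
      subst₂ _≤_ (edges≡S[] A B) (rearrange (δ + ε)) (proj₂ bounds)
      where
      bounds = edges-between A B A⊆Gi B⊆Gj (subst₂ (λ x y → ε * x < y) (sym (count-toℚ Gi)) (sym (count-toℚ A)) A-big) B-big
      rearrange : ∀ c → c * (toℚ (count A) * nB) ≡ c * nB * cnt A
      rearrange c = trans (cong (λ z → c * (z * nB)) (count-toℚ A))
                          (solve 3 (λ c a b → c :* (a :* b) := c :* b :* a) refl c (cnt A) nB)

∧-absorb : ∀ a b → (T a → T b) → (a ∧ b) ≡ a
∧-absorb false b h = refl
∧-absorb true false h = ⊥-elim (h tt)
∧-absorb true true h = refl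

true-∧ : ∀ {a} b → T a → (a ∧ b) ≡ b
true-∧ {true} b _ = refl

density≤1 : ∀ {m n} (P Q : Fin m → Fin n → Bool) → (∀ a b → T (P a b) → T (Q a b)) →
  ratio (count2 P) (count2 Q) ≤ 1ℚ
density≤1 P Q P⊆Q = ratio≤1 (count2 P) (count2 Q) (count2-mono P Q P⊆Q)

module ComplexFacts {n₁ n₂ n₃ : ℕ} (G : Complex3 n₁ n₂ n₃) where

  module Pairs = Sums (pairSum n₁ n₂)
  open Pairs using (S; S[_])

  g123⊆star123 : ∀ a b c → T (g123 G a b c) → T (star123 G a b c)
  g123⊆star123 a b c t =
    ∧-intro (proj₁ (dc12 G a b t12)) (∧-intro (proj₂ (dc12 G a b t12)) (∧-intro (proj₂ (dc13 G a c t13))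
      (∧-intro t12 (∧-intro t13 t23))))
    where
    t12 = proj₁ (dc123 G a b c t)
    t13 = proj₁ (proj₂ (dc123 G a b c t))
    t23 = proj₂ (proj₂ (dc123 G a b c t))

  d12≤1 : d12 G ≤ 1ℚ
  d12≤1 = density≤1 (g12 G) (star12 G) (λ a b t → ∧-intro (proj₁ (dc12 G a b t)) (proj₂ (dc12 G a b t)))

  d13≤1 : d13 G ≤ 1ℚ
  d13≤1 = density≤1 (g13 G) (star13 G) (λ a c t → ∧-intro (proj₁ (dc13 G a c t)) (proj₂ (dc13 G a c t)))

  d23≤1 : d23 G ≤ 1ℚ
  d23≤1 = density≤1 (g23 G) (star23 G) (λ b c t → ∧-intro (proj₁ (dc23 G b c t)) (proj₂ (dc23 G b c t)))

  d123≤1 : d123 G ≤ 1ℚ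
  d123≤1 = ratio≤1 (count3 (g123 G)) (count3 (star123 G)) (count3-mono (g123 G) (star123 G) g123⊆star123)

  starDeg linkDeg : Fin n₁ × Fin n₂ → ℚ
  starDeg (u , v) = toℚ (count (star123 G u v))
  linkDeg (u , v) = toℚ (count (g123 G u v))

  count3-over : ∀ (P : Fin n₁ × Fin n₂ → Bool) (Q : Fin n₁ → Fin n₂ → Fin n₃ → Bool) →
    toℚ (count3 (λ u v z → P (u , v) ∧ Q u v z)) ≡ S[ P ] (λ p → toℚ (count (Q (proj₁ p) (proj₂ p))))
  count3-over P Q = trans (count3-toℚ (λ u v z → P (u , v) ∧ Q u v z))
    (sumQ-cong (λ u → trans (count2-toℚ (λ v z → P (u , v) ∧ Q u v z))
    (sumQ-cong (λ v → count-sel (P (u , v)) (Q u v)))))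

  count3-pairs : ∀ (Q : Fin n₁ → Fin n₂ → Fin n₃ → Bool) →
    toℚ (count3 Q) ≡ S (λ p → toℚ (count (Q (proj₁ p) (proj₂ p))))
  count3-pairs Q = trans (count3-toℚ Q) (sumQ-cong (λ u → count2-toℚ (Q u)))

  link-total : 0ℚ < d123 G → S linkDeg ≡ d123 G * S starDeg
  link-total D-pos = begin
    S linkDeg                      ≡⟨ sym (count3-pairs (g123 G)) ⟩
    toℚ (count3 (g123 G))          ≡⟨ sym (ratio-eq (count3 (g123 G)) (count3 (star123 G))
                                         (proj₂ (ratio-pos (count3 (g123 G)) (count3 (star123 G)) D-pos))) ⟩
    d123 G * toℚ (count3 (star123 G)) ≡⟨ cong (d123 G *_) (count3-pairs (star123 G)) ⟩
    d123 G * S starDeg             ∎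
    where open ≡-Reasoning

  starDeg₁ linkDeg₁ : Fin n₁ → ℚ
  starDeg₁ u = toℚ (count2 (star123 G u))
  linkDeg₁ u = toℚ (count2 (g123 G u))

  over-vertices : ∀ (B : Fin n₁ → Bool) (Q : Fin n₁ → Fin n₂ → Fin n₃ → Bool) →
    sumQ (λ u → sel (B u) (toℚ (count2 (Q u)))) ≡ S[ (λ p → B (proj₁ p)) ] (λ p → toℚ (count (Q (proj₁ p) (proj₂ p))))
  over-vertices B Q = sumQ-cong (λ u → trans (cong (sel (B u)) (count2-toℚ (Q u)))
                                             (sumQ-sel (B u) (λ v → toℚ (count (Q u v)))))

  restrict12 : (Fin n₁ × Fin n₂ → Bool) → Sub3 G
  restrict12 P = record
    { j1 = g1 G ; j2 = g2 G ; j3 = g3 G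
    ; j12 = λ u v → P (u , v) ∧ g12 G u v ; j13 = g13 G ; j23 = g23 G
    ; sub1 = λ _ t → t ; sub2 = λ _ t → t ; sub3 = λ _ t → t
    ; sub12 = λ u v t → ∧-snd {P (u , v)} t ; sub13 = λ _ _ t → t ; sub23 = λ _ _ t → t
    ; jdc12 = λ u v t → dc12 G u v (∧-snd {P (u , v)} t) ; jdc13 = dc13 G ; jdc23 = dc23 G }

  Jstar-restrict12 : ∀ P u v z → Jstar123 (restrict12 P) u v z ≡ (P (u , v) ∧ star123 G u v z)
  Jstar-restrict12 P u v z = solve-∧ 7 (λ p a b c ab ac bc →
    (a ⊕ b ⊕ c ⊕ (p ⊕ ab) ⊕ ac ⊕ bc) ⊜ (p ⊕ (a ⊕ b ⊕ c ⊕ ab ⊕ ac ⊕ bc))) refl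
    (P (u , v)) (g1 G u) (g2 G v) (g3 G z) (g12 G u v) (g13 G u z) (g23 G v z)

  rstar-restrict12 : ∀ P u v z → rstar123 (restrict12 P) u v z ≡ (P (u , v) ∧ star123 G u v z)
  rstar-restrict12 P u v z = solve-∧ 7 (λ p a b c ab ac bc →
    ((a ⊕ a) ⊕ (b ⊕ b) ⊕ (c ⊕ c) ⊕ (ab ⊕ (p ⊕ ab) ⊕ a ⊕ b) ⊕ (ac ⊕ ac ⊕ a ⊕ c) ⊕ (bc ⊕ bc ⊕ b ⊕ c))
      ⊜ (p ⊕ (a ⊕ b ⊕ c ⊕ ab ⊕ ac ⊕ bc))) refl
    (P (u , v)) (g1 G u) (g2 G v) (g3 G z) (g12 G u v) (g13 G u z) (g23 G v z)

  r123-restrict12 : ∀ P u v z → r123 (restrict12 P) u v z ≡ (P (u , v) ∧ g123 G u v z)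
  r123-restrict12 P u v z = begin
    g123 G u v z ∧ Jstar123 (restrict12 P) u v z ≡⟨ cong (g123 G u v z ∧_) (Jstar-restrict12 P u v z) ⟩
    g123 G u v z ∧ (P (u , v) ∧ star123 G u v z)
      ≡⟨ solve-∧ 8 (λ t p a b c ab ac bc → (t ⊕ (p ⊕ (a ⊕ b ⊕ c ⊕ ab ⊕ ac ⊕ bc))) ⊜ (p ⊕ (t ⊕ (a ⊕ b ⊕ c ⊕ ab ⊕ ac ⊕ bc)))) refl
           (g123 G u v z) (P (u , v)) (g1 G u) (g2 G v) (g3 G z) (g12 G u v) (g13 G u z) (g23 G v z) ⟩
    P (u , v) ∧ (g123 G u v z ∧ star123 G u v z) ≡⟨ cong (P (u , v) ∧_) (∧-absorb _ _ (g123⊆star123 u v z)) ⟩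
    P (u , v) ∧ g123 G u v z ∎
    where open ≡-Reasoning

  regular-on-pairs : ∀ {ε} → NonNeg ε → tripleRegular ε G → ∀ (P : Fin n₁ × Fin n₂ → Bool) →
    ε * S starDeg < S[ P ] starDeg →
    ((d123 G - ε) * S[ P ] starDeg ≤ S[ P ] linkDeg) × (S[ P ] linkDeg ≤ (d123 G + ε) * S[ P ] starDeg)
  regular-on-pairs {ε} ε-nonneg reg P big =
    subst₂ (λ x y → (d123 G - ε) * x ≤ y) stars links (proj₁ bounds) ,
    subst₂ (λ x y → y ≤ (d123 G + ε) * x) stars links (proj₂ bounds)
    where
    Jᴾ = restrict12 P
    Jstars : toℚ (count3 (Jstar123 Jᴾ)) ≡ S[ P ] starDeg
    Jstars = trans (cong toℚ (count3-cong (Jstar-restrict12 P))) (count3-over P (star123 G))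
    stars : toℚ (count3 (rstar123 Jᴾ)) ≡ S[ P ] starDeg
    stars = trans (cong toℚ (count3-cong (rstar-restrict12 P))) (count3-over P (star123 G))
    links : toℚ (count3 (r123 Jᴾ)) ≡ S[ P ] linkDeg
    links = trans (cong toℚ (count3-cong (r123-restrict12 P))) (count3-over P (g123 G))
    J-big : ε * toℚ (count3 (star123 G)) < toℚ (count3 (Jstar123 Jᴾ))
    J-big = subst₂ (λ x y → ε * x < y) (sym (count3-pairs (star123 G))) (sym Jstars) big
    stars-pos : 0ℚ < toℚ (count3 (rstar123 Jᴾ))
    stars-pos = subst (0ℚ <_) (sym stars)
      (≤-<-trans (*-nonneg ε-nonneg (subst NonNeg (count3-pairs (star123 G)) (toℚ-nonneg (count3 (star123 G))))) big)
    bounds = ratio-± (count3 (r123 Jᴾ)) (count3 (rstar123 Jᴾ)) (d123 G) ε stars-pos (reg Jᴾ J-big)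

  regular-on-vertices : ∀ {ε} → NonNeg ε → tripleRegular ε G → ∀ (B : Fin n₁ → Bool) →
    ε * sumQ starDeg₁ < sumQ (λ u → sel (B u) (starDeg₁ u)) →
    ((d123 G - ε) * sumQ (λ u → sel (B u) (starDeg₁ u)) ≤ sumQ (λ u → sel (B u) (linkDeg₁ u))) ×
    (sumQ (λ u → sel (B u) (linkDeg₁ u)) ≤ (d123 G + ε) * sumQ (λ u → sel (B u) (starDeg₁ u)))
  regular-on-vertices {ε} ε-nonneg reg B big =
    subst₂ (λ x y → (d123 G - ε) * x ≤ y) (sym stars) (sym links) (proj₁ bounds) ,
    subst₂ (λ x y → y ≤ (d123 G + ε) * x) (sym stars) (sym links) (proj₂ bounds)
    where
    stars = over-vertices B (star123 G)
    links = over-vertices B (g123 G)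
    bounds = regular-on-pairs ε-nonneg reg (λ p → B (proj₁ p))
      (subst₂ (λ x y → ε * x < y) (over-vertices (λ _ → true) (star123 G)) stars big)

shrink : ∀ {ε N} → ε < 1ℚ → 0ℚ < N → ε * N < N
shrink {ε} {N} ε<1 N-pos = subst (ε * N <_) (*-identityˡ N) (*-monoˡ-<-pos N {{positive N-pos}} ε<1)

less-two : ∀ {ε a} → ε + ε + ε < a → ε < a - (ε + ε)
less-two {ε} {a} h = cert< _ (solve 2 (λ ε a → (a :- (ε :+ ε)) :- ε := a :- (ε :+ ε :+ ε)) refl ε a) (<⇒diff h)

plus-four : ∀ {ε x} → NonNeg ε → NonNeg (x - (ε + ε)) → NonNeg (x + (ε + ε))
plus-four {ε} {x} ε0 h = subst NonNeg (solve 2 (λ x ε → (x :- (ε :+ ε)) :+ ((ε :+ ε) :+ (ε :+ ε)) := x :+ (ε :+ ε)) refl x ε)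
  (+-nonneg h (+-nonneg (+-nonneg ε0 ε0) (+-nonneg ε0 ε0)))

-- A vertex is typical if its
-- degrees into G_2 and G_3 are close to d12|G_2| and d13|G_3|; then its
-- star is the G_23-graph between two big neighbourhoods, of size about
-- d23 d12 d13 |G_2||G_3| by regularity of G_23.
module PartI {n₁ n₂ n₃ : ℕ} (G : Complex3 n₁ n₂ n₃) (ε : ℚ) (ε-pos : 0ℚ < ε) (R : Regular ε G)
  (N1-pos : 0ℚ < toℚ (count (g1 G))) (N2-pos : 0ℚ < toℚ (count (g2 G))) (N3-pos : 0ℚ < toℚ (count (g3 G)))
  (ε<1 : ε < 1ℚ) (a-big : ε + ε + ε < d12 G) (b-big : ε + ε + ε < d13 G) (c-ε : NonNeg (d23 G - ε))
  (D-pos : 0ℚ < d123 G) where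

  open ComplexFacts G
  module V = Sums (vertexSum n₁)
  open ≤-Reasoning

  N1 N2 N3 M a b c D : ℚ
  N1 = toℚ (count (g1 G))
  N2 = toℚ (count (g2 G))
  N3 = toℚ (count (g3 G))
  M = N2 * N3
  a = d12 G
  b = d13 G
  c = d23 G
  D = d123 G

  ε0 : NonNeg ε
  ε0 = <⇒≤ ε-pos

  module P12 = PairRegularity ε ε-pos (g1 G) (g2 G) (g12 G) (proj₁ R)
  module P13 = PairRegularity ε ε-pos (g1 G) (g3 G) (g13 G) (proj₁ (proj₂ R))
  module P23 = PairRegularity ε ε-pos (g2 G) (g3 G) (g23 G) (proj₁ (proj₂ (proj₂ R)))

  typical12 typical13 typical : Fin n₁ → Bool
  typical12 = P12.typical (g2 G)
  typical13 = P13.typical (g3 G)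
  typical v = g1 G v ∧ (typical12 v ∧ typical13 v)

  -- Star sizes of typical vertices lie in [ℓM, w'M]; at most ηN1 vertices
  -- are atypical.
  ℓ w' η σ : ℚ
  ℓ = (c - ε) * ((a - (ε + ε)) * (b - (ε + ε)))
  w' = (c + ε) * ((a + (ε + ε)) * (b + (ε + ε)))
  η = ε + ε + ε + ε
  σ = w' - ℓ + η

  a-2ε : NonNeg (a - (ε + ε))
  a-2ε = ≤-trans ε0 (<⇒≤ (less-two {ε} {a} a-big))
  b-2ε : NonNeg (b - (ε + ε))
  b-2ε = ≤-trans ε0 (<⇒≤ (less-two {ε} {b} b-big))
  c+ε : NonNeg (c + ε)
  c+ε = subst NonNeg (solve 2 (λ c ε → (c :- ε) :+ (ε :+ ε) := c :+ ε) refl c ε) (+-nonneg c-ε (+-nonneg ε0 ε0))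

  nbr2 : Fin n₁ → Fin n₂ → Bool
  nbr2 v y = g2 G y ∧ g12 G v y
  nbr3 : Fin n₁ → Fin n₃ → Bool
  nbr3 v z = g3 G z ∧ g13 G v z

  star-as-edges : ∀ v → T (g1 G v) → starDeg₁ v ≡ P23.edges (nbr2 v) (nbr3 v)
  star-as-edges v v∈G1 = cong toℚ (count2-cong (λ y z → trans (true-∧ _ v∈G1)
    (solve-∧ 5 (λ y z p q s → (y ⊕ z ⊕ p ⊕ q ⊕ s) ⊜ ((y ⊕ p) ⊕ (z ⊕ q) ⊕ s)) refl
      (g2 G y) (g3 G z) (g12 G v y) (g13 G v z) (g23 G y z))))

  typical-weight : ∀ v → T (typical v) → (ℓ * M ≤ starDeg₁ v) × (starDeg₁ v ≤ w' * M)
  typical-weight v t = lower , upper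
    where
    t12 = V.within-bounds (P12.deg (g2 G)) _ _ v (∧-fst {typical12 v} (∧-snd {g1 G v} t))
    t13 = V.within-bounds (P13.deg (g3 G)) _ _ v (∧-snd {typical12 v} (∧-snd {g1 G v} t))
    nA = toℚ (count (nbr2 v))
    nB = toℚ (count (nbr3 v))
    A-big : ε * N2 < nA
    A-big = <-≤-trans (*-monoˡ-<-pos N2 {{positive N2-pos}} (less-two {ε} {a} a-big)) (proj₁ t12)
    B-big : ε * N3 < nB
    B-big = <-≤-trans (*-monoˡ-<-pos N3 {{positive N3-pos}} (less-two {ε} {b} b-big)) (proj₁ t13)
    edges = P23.edges-between (nbr2 v) (nbr3 v) (λ y u → ∧-fst {g2 G y} u) (λ z u → ∧-fst {g3 G z} u) A-big B-big
    star≡ = star-as-edges v (∧-fst {g1 G v} t)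
    lower = begin
      ℓ * M ≡⟨ solve 6 (λ c a b e N2 N3 → (c :- e) :* ((a :- (e :+ e)) :* (b :- (e :+ e))) :* (N2 :* N3) :=
                 (c :- e) :* (((a :- (e :+ e)) :* N2) :* ((b :- (e :+ e)) :* N3))) refl c a b ε N2 N3 ⟩
      (c - ε) * (((a - (ε + ε)) * N2) * ((b - (ε + ε)) * N3))
        ≤⟨ mulˡ (c - ε) c-ε (mul-mono (*-nonneg a-2ε (<⇒≤ N2-pos)) (toℚ-nonneg (count (nbr3 v))) (proj₁ t12) (proj₁ t13)) ⟩
      (c - ε) * (nA * nB) ≤⟨ proj₁ edges ⟩
      P23.edges (nbr2 v) (nbr3 v) ≡⟨ sym star≡ ⟩
      starDeg₁ v ∎
    upper = begin
      starDeg₁ v ≡⟨ star≡ ⟩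
      P23.edges (nbr2 v) (nbr3 v) ≤⟨ proj₂ edges ⟩
      (c + ε) * (nA * nB)
        ≤⟨ mulˡ (c + ε) c+ε (mul-mono (toℚ-nonneg (count (nbr2 v))) (*-nonneg (plus-four {ε} {b} ε0 b-2ε) (<⇒≤ N3-pos)) (proj₂ t12) (proj₂ t13)) ⟩
      (c + ε) * (((a + (ε + ε)) * N2) * ((b + (ε + ε)) * N3))
        ≡⟨ solve 6 (λ c a b e N2 N3 → (c :+ e) :* (((a :+ (e :+ e)) :* N2) :* ((b :+ (e :+ e)) :* N3)) :=
                 (c :+ e) :* ((a :+ (e :+ e)) :* (b :+ (e :+ e))) :* (N2 :* N3)) refl c a b ε N2 N3 ⟩
      w' * M ∎

  weight-bounded : ∀ v → starDeg₁ v ≤ sel (g1 G v) M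
  weight-bounded v = begin
    starDeg₁ v ≤⟨ count2-mono (star123 G v) (λ y z → g1 G v ∧ (g2 G y ∧ g3 G z))
                    (λ y z t → ∧-intro (∧-fst {g1 G v} t) (∧-intro (∧-fst {g2 G y} (∧-snd {g1 G v} t))
                      (∧-fst {g3 G z} (∧-snd {g2 G y} (∧-snd {g1 G v} t))))) ⟩
    toℚ (count2 (λ y z → g1 G v ∧ (g2 G y ∧ g3 G z))) ≡⟨ count2-sel (g1 G v) (λ y z → g2 G y ∧ g3 G z) ⟩
    sel (g1 G v) (toℚ (count2 (λ y z → g2 G y ∧ g3 G z))) ≡⟨ cong (sel (g1 G v)) (count2-prod (g2 G) (g3 G)) ⟩
    sel (g1 G v) M ∎

  size : V.cnt (g1 G) ≡ N1
  size = sym (count-toℚ (g1 G))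

  atypical : V.cnt (λ v → g1 G v ∧ not (typical v)) ≤ η * N1
  atypical = begin
    V.cnt (λ v → g1 G v ∧ not (typical v))
      ≡⟨ V.S-cong (λ v → cong ind (∧-not-guarded (g1 G v) (typical12 v ∧ typical13 v))) ⟩
    V.cnt (λ v → g1 G v ∧ not (typical12 v ∧ typical13 v)) ≤⟨ V.cnt-∧-not (g1 G) typical12 typical13 ⟩
    V.cnt (λ v → g1 G v ∧ not (typical12 v)) + V.cnt (λ v → g1 G v ∧ not (typical13 v))
      ≤⟨ +-mono-≤ (P12.few-atypical (g2 G) (λ _ t → t) (shrink ε<1 N2-pos))
                 (P13.few-atypical (g3 G) (λ _ t → t) (shrink ε<1 N3-pos)) ⟩
    (ε * V.cnt (g1 G) + ε * V.cnt (g1 G)) + (ε * V.cnt (g1 G) + ε * V.cnt (g1 G))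
      ≡⟨ cong (λ N → (ε * N + ε * N) + (ε * N + ε * N)) size ⟩
    (ε * N1 + ε * N1) + (ε * N1 + ε * N1)
      ≡⟨ solve 2 (λ e N → (e :* N :+ e :* N) :+ (e :* N :+ e :* N) := (e :+ e :+ e :+ e) :* N) refl ε N1 ⟩
    η * N1 ∎

  r : ℚ
  r = ratio (count3 (g123 G)) (count (g1 G))

  system : 0ℚ < ℓ * M → NonNeg (D - ε) → V.WeightedSystem
  system L-pos D-ε = record
    { X = g1 G ; Tp = typical ; Tp⊆X = λ v t → ∧-fst {g1 G v} t
    ; weight = starDeg₁ ; link = linkDeg₁
    ; N = N1 ; L = ℓ * M ; W = (ℓ + σ) * M ; D = D ; r = r ; ε = ε ; η = η
    ; N-pos = N1-pos ; L-pos = L-pos ; ε-nonneg = ε0 ; D-ε-nonneg = D-ε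
    ; size = size ; atypical = atypical
    ; weight-nonneg = λ v → toℚ-nonneg (count2 (star123 G v))
    ; weight-typical = λ v t → proj₁ (typical-weight v t) , ≤-trans (proj₂ (typical-weight v t)) (mulʳ M M0 w'≤ℓ+σ)
    ; weight-total = subst (λ W → V.S starDeg₁ ≤ N1 * W) (solve 4 (λ w l η M → w :* M :+ η :* M := (l :+ (w :- l :+ η)) :* M) refl w' ℓ η M)
        (V.total-weight (g1 G) typical starDeg₁ (w' * M) M N1 η (λ v t → ∧-fst {g1 G v} t)
          (*-nonneg (*-nonneg c+ε (*-nonneg (plus-four {ε} {a} ε0 a-2ε) (plus-four {ε} {b} ε0 b-2ε))) M0) M0
          weight-bounded (λ v t → proj₂ (typical-weight v t)) size atypical)
    ; link-total = trans (over-vertices (λ _ → true) (g123 G)) (trans (link-total D-pos) (cong (D *_) (sym (over-vertices (λ _ → true) (star123 G)))))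
    ; mean = trans (ratio-eq (count3 (g123 G)) (count (g1 G)) N1-pos) (count3-toℚ (g123 G))
    ; regular = regular-on-vertices ε0 (proj₂ (proj₂ (proj₂ R)))
    }
    where
    M0 : NonNeg M
    M0 = *-nonneg (<⇒≤ N2-pos) (<⇒≤ N3-pos)
    w'≤ℓ+σ : w' ≤ ℓ + σ
    w'≤ℓ+σ = cert≤ _ (solve 3 (λ w l η → (l :+ (w :- l :+ η)) :- w := η) refl w' ℓ η)
      (+-nonneg (+-nonneg (+-nonneg ε0 ε0) ε0) ε0)

  conclusion : ∀ ε' (L-pos : 0ℚ < ℓ * M) (D-ε : NonNeg (D - ε)) →
    Thresholds ε η (ℓ * M) ((ℓ + σ) * M) D ε' → ConclusionI ε' G
  conclusion ε' L-pos D-ε thresholds =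
    proj₁ result , subst (_≤ ε' * N1) (sym (count-toℚ (proj₁ result))) (proj₁ (proj₂ result)) , proj₂ (proj₂ result)
    where
    result = V.Concentration.concentration (system L-pos D-ε) ε' thresholds

-- A pair uv ∈ G_12 fails "u typical (t13) and v typical for u (t23)"
-- either because u is atypical, or because u is typical and v is not.
pair-atypical : ∀ x g₁ g₂ t13 t23 → (T x → T g₁ × T g₂) →
  ind (x ∧ not (x ∧ ((g₁ ∧ t13) ∧ (g₂ ∧ t23)))) ≤ ind ((g₁ ∧ not t13) ∧ g₂) + ind ((g₁ ∧ t13) ∧ (g₂ ∧ not t23))
pair-atypical false g₁ g₂ t13 t23 h = +-nonneg (ind-nonneg ((g₁ ∧ not t13) ∧ g₂)) (ind-nonneg ((g₁ ∧ t13) ∧ (g₂ ∧ not t23)))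
pair-atypical true g₁ g₂ t13 t23 h with h tt
pair-atypical true true true false t23 h | _ = ≤-reflexive (sym (+-identityʳ 1ℚ))
pair-atypical true true true true t23 h | _ = ≤-reflexive (sym (+-identityˡ (ind (not t23))))

-- A pair is typical if u has
-- typical degree into G_3 and v has typical degree into the neighbourhood
-- G(u)_3; then |G*(uv)_3| ≈ d23 d13 |G_3|.
module PartII {n₁ n₂ n₃ : ℕ} (G : Complex3 n₁ n₂ n₃) (ε : ℚ) (ε-pos : 0ℚ < ε) (R : Regular ε G)
  (N1-pos : 0ℚ < toℚ (count (g1 G))) (N2-pos : 0ℚ < toℚ (count (g2 G))) (N3-pos : 0ℚ < toℚ (count (g3 G)))
  (ε<1 : ε < 1ℚ) (b-big : ε + ε + ε < d13 G) (c-big : ε + ε + ε < d23 G)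
  (D-pos : 0ℚ < d123 G) (a-pos : 0ℚ < d12 G)
  (η : ℚ) (η-bound : ε + ε + ε + ε ≤ η * d12 G) where

  open ComplexFacts G
  module V = Sums (vertexSum n₁)
  module V₂ = Sums (vertexSum n₂)
  open PairCounts {n₁} {n₂}
  open ≤-Reasoning

  N1 N2 N3 a b c D N : ℚ
  N1 = toℚ (count (g1 G))
  N2 = toℚ (count (g2 G))
  N3 = toℚ (count (g3 G))
  a = d12 G
  b = d13 G
  c = d23 G
  D = d123 G
  N = toℚ (count2 (g12 G))

  ε0 : NonNeg ε
  ε0 = <⇒≤ ε-pos

  module P13 = PairRegularity ε ε-pos (g1 G) (g3 G) (g13 G) (proj₁ (proj₂ R))
  module P23 = PairRegularity ε ε-pos (g2 G) (g3 G) (g23 G) (proj₁ (proj₂ (proj₂ R)))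

  nbr3 : Fin n₁ → Fin n₃ → Bool
  nbr3 u z = g3 G z ∧ g13 G u z

  typical13 : Fin n₁ → Bool
  typical13 = P13.typical (g3 G)

  typical23 : Fin n₁ → Fin n₂ → Bool
  typical23 u = P23.typical (nbr3 u)

  typical : Fin n₁ × Fin n₂ → Bool
  typical (u , v) = g12 G u v ∧ ((g1 G u ∧ typical13 u) ∧ (g2 G v ∧ typical23 u v))

  ℓ w' σ : ℚ
  ℓ = (c - (ε + ε)) * (b - (ε + ε))
  w' = (c + (ε + ε)) * (b + (ε + ε))
  σ = w' - ℓ + η

  b-2ε : NonNeg (b - (ε + ε))
  b-2ε = ≤-trans ε0 (<⇒≤ (less-two {ε} {b} b-big))
  c-2ε : NonNeg (c - (ε + ε))
  c-2ε = ≤-trans ε0 (<⇒≤ (less-two {ε} {c} c-big))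

  nbr-size : ∀ u → T (typical13 u) → ((b - (ε + ε)) * N3 ≤ toℚ (count (nbr3 u))) × (toℚ (count (nbr3 u)) ≤ (b + (ε + ε)) * N3)
  nbr-size u t = V.within-bounds (P13.deg (g3 G)) _ _ u t

  nbr-big : ∀ u → T (typical13 u) → ε * N3 < toℚ (count (nbr3 u))
  nbr-big u t = <-≤-trans (*-monoˡ-<-pos N3 {{positive N3-pos}} (less-two {ε} {b} b-big)) (proj₁ (nbr-size u t))

  star-as-degree : ∀ u v → T (g12 G u v) → starDeg (u , v) ≡ P23.deg (nbr3 u) v
  star-as-degree u v uv∈G12 = cong toℚ (count-cong (λ z → trans
    (solve-∧ 6 (λ x y z p q s → (x ⊕ y ⊕ z ⊕ p ⊕ q ⊕ s) ⊜ ((x ⊕ y ⊕ p) ⊕ ((z ⊕ q) ⊕ s))) refl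
      (g1 G u) (g2 G v) (g3 G z) (g12 G u v) (g13 G u z) (g23 G v z))
    (true-∧ _ (∧-intro (proj₁ (dc12 G u v uv∈G12)) (∧-intro (proj₂ (dc12 G u v uv∈G12)) uv∈G12)))))

  typical-weight : ∀ p → T (typical p) → (ℓ * N3 ≤ starDeg p) × (starDeg p ≤ w' * N3)
  typical-weight (u , v) t = lower , upper
    where
    t13 = ∧-fst {g1 G u ∧ typical13 u} (∧-snd {g12 G u v} t)
    t23 = ∧-snd {g1 G u ∧ typical13 u} (∧-snd {g12 G u v} t)
    size3 = nbr-size u (∧-snd {g1 G u} t13)
    degree = V₂.within-bounds (P23.deg (nbr3 u)) _ _ v (∧-snd {g2 G v} t23)
    star≡ = star-as-degree u v (∧-fst {g12 G u v} t)
    lower = begin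
      ℓ * N3 ≡⟨ *-assoc (c - (ε + ε)) (b - (ε + ε)) N3 ⟩
      (c - (ε + ε)) * ((b - (ε + ε)) * N3) ≤⟨ mulˡ _ c-2ε (proj₁ size3) ⟩
      (c - (ε + ε)) * toℚ (count (nbr3 u)) ≤⟨ proj₁ degree ⟩
      P23.deg (nbr3 u) v ≡⟨ sym star≡ ⟩
      starDeg (u , v) ∎
    upper = begin
      starDeg (u , v) ≡⟨ star≡ ⟩
      P23.deg (nbr3 u) v ≤⟨ proj₂ degree ⟩
      (c + (ε + ε)) * toℚ (count (nbr3 u)) ≤⟨ mulˡ _ (plus-four {ε} {c} ε0 c-2ε) (proj₂ size3) ⟩
      (c + (ε + ε)) * ((b + (ε + ε)) * N3) ≡⟨ sym (*-assoc (c + (ε + ε)) (b + (ε + ε)) N3) ⟩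
      w' * N3 ∎

  weight-bounded : ∀ p → starDeg p ≤ sel (g12 G (proj₁ p) (proj₂ p)) N3
  weight-bounded (u , v) = begin
    starDeg (u , v) ≤⟨ count-mono (star123 G u v) (λ z → g12 G u v ∧ g3 G z)
        (λ z t → ∧-intro (∧-fst {g12 G u v} (∧-snd {g3 G z} (∧-snd {g2 G v} (∧-snd {g1 G u} t))))
                         (∧-fst {g3 G z} (∧-snd {g2 G v} (∧-snd {g1 G u} t)))) ⟩
    toℚ (count (λ z → g12 G u v ∧ g3 G z)) ≡⟨ count-sel (g12 G u v) (g3 G) ⟩
    sel (g12 G u v) N3 ∎

  N≡ : N ≡ a * (N1 * N2)
  N≡ = trans (sym (ratio-eq (count2 (g12 G)) (count2 (star12 G)) (subst (0ℚ <_) (sym product) (*-pos N1-pos N2-pos))))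
             (cong (a *_) product)
    where
    product = count2-prod (g1 G) (g2 G)

  N-pos : 0ℚ < N
  N-pos = subst (0ℚ <_) (sym N≡) (*-pos a-pos (*-pos N1-pos N2-pos))

  X : Fin n₁ × Fin n₂ → Bool
  X p = g12 G (proj₁ p) (proj₂ p)

  -- Atypical pairs: u atypical (at most 2εN1 · N2), or u typical and v
  -- atypical for the big set G(u)_3 (at most N1 · 2εN2).
  atypical : Pairs.cnt (λ p → X p ∧ not (typical p)) ≤ η * N
  atypical = begin
    Pairs.cnt (λ p → X p ∧ not (typical p))
      ≤⟨ ≤-trans (Pairs.S-mono (λ p → pair-atypical (X p) (g1 G (proj₁ p)) (g2 G (proj₂ p)) (typical13 (proj₁ p))
                                   (typical23 (proj₁ p) (proj₂ p)) (dc12 G (proj₁ p) (proj₂ p))))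
                 (≤-reflexive (Pairs.S-+ _ _)) ⟩
    Pairs.cnt (λ p → (g1 G (proj₁ p) ∧ not (typical13 (proj₁ p))) ∧ g2 G (proj₂ p))
      + Pairs.cnt (λ p → (g1 G (proj₁ p) ∧ typical13 (proj₁ p)) ∧ (g2 G (proj₂ p) ∧ not (typical23 (proj₁ p) (proj₂ p))))
      ≡⟨ cong₂ _+_ (cnt-fibred (λ u → g1 G u ∧ not (typical13 u)) (λ _ → g2 G))
                   (cnt-fibred (λ u → g1 G u ∧ typical13 u) (λ u v → g2 G v ∧ not (typical23 u v))) ⟩
    V.S[ (λ u → g1 G u ∧ not (typical13 u)) ] (λ _ → N2)
      + V.S[ (λ u → g1 G u ∧ typical13 u) ] (λ u → toℚ (count (λ v → g2 G v ∧ not (typical23 u v))))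
      ≤⟨ +-mono-≤ (V.S-upper _ (λ _ → N2) N2 (λ _ _ → ≤-refl))
                  (V.S-upper _ _ (ε * N2 + ε * N2) (λ u t → few-atypical23 u (∧-snd {g1 G u} t))) ⟩
    N2 * V.cnt (λ u → g1 G u ∧ not (typical13 u)) + (ε * N2 + ε * N2) * V.cnt (λ u → g1 G u ∧ typical13 u)
      ≤⟨ +-mono-≤ (mulˡ N2 (<⇒≤ N2-pos) few-atypical13)
                  (mulˡ (ε * N2 + ε * N2) εN2 (subst (V.cnt (λ u → g1 G u ∧ typical13 u) ≤_) (sym (count-toℚ (g1 G)))
                     (V.cnt-mono _ (g1 G) (λ u t → ∧-fst {g1 G u} t)))) ⟩
    N2 * (ε * N1 + ε * N1) + (ε * N2 + ε * N2) * N1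
      ≡⟨ solve 3 (λ e N1 N2 → N2 :* (e :* N1 :+ e :* N1) :+ (e :* N2 :+ e :* N2) :* N1 := (e :+ e :+ e :+ e) :* (N1 :* N2)) refl ε N1 N2 ⟩
    (ε + ε + ε + ε) * (N1 * N2) ≤⟨ mulʳ (N1 * N2) (<⇒≤ (*-pos N1-pos N2-pos)) η-bound ⟩
    η * a * (N1 * N2) ≡⟨ trans (*-assoc η a (N1 * N2)) (cong (η *_) (sym N≡)) ⟩
    η * N ∎
    where
    εN2 : NonNeg (ε * N2 + ε * N2)
    εN2 = +-nonneg (*-nonneg ε0 (<⇒≤ N2-pos)) (*-nonneg ε0 (<⇒≤ N2-pos))
    few-atypical13 : V.cnt (λ u → g1 G u ∧ not (typical13 u)) ≤ ε * N1 + ε * N1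
    few-atypical13 = subst (λ N → V.cnt (λ u → g1 G u ∧ not (typical13 u)) ≤ ε * N + ε * N) (sym (count-toℚ (g1 G)))
                       (P13.few-atypical (g3 G) (λ _ t → t) (shrink ε<1 N3-pos))
    few-atypical23 : ∀ u → T (typical13 u) → toℚ (count (λ v → g2 G v ∧ not (typical23 u v))) ≤ ε * N2 + ε * N2
    few-atypical23 u t = subst₂ (λ x N → x ≤ ε * N + ε * N) (sym (count-toℚ (λ v → g2 G v ∧ not (typical23 u v))))
                           (sym (count-toℚ (g2 G)))
                           (P23.few-atypical (nbr3 u) (λ z w → ∧-fst {g3 G z} w) (nbr-big u t))

  r : ℚ
  r = ratio (count3 (g123 G)) (count2 (g12 G))

  system : 0ℚ < ℓ * N3 → NonNeg (D - ε) → NonNeg η → Pairs.WeightedSystem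
  system L-pos D-ε η0 = record
    { X = X ; Tp = typical ; Tp⊆X = λ p t → ∧-fst {X p} t
    ; weight = starDeg ; link = linkDeg
    ; N = N ; L = ℓ * N3 ; W = (ℓ + σ) * N3 ; D = D ; r = r ; ε = ε ; η = η
    ; N-pos = N-pos ; L-pos = L-pos ; ε-nonneg = ε0 ; D-ε-nonneg = D-ε
    ; size = size ; atypical = atypical
    ; weight-nonneg = λ p → toℚ-nonneg (count (star123 G (proj₁ p) (proj₂ p)))
    ; weight-typical = λ p t → proj₁ (typical-weight p t) , ≤-trans (proj₂ (typical-weight p t)) (mulʳ N3 N3-nonneg w'≤ℓ+σ)
    ; weight-total = subst (λ W → Pairs.S starDeg ≤ N * W) (solve 4 (λ w l η M → w :* M :+ η :* M := (l :+ (w :- l :+ η)) :* M) refl w' ℓ η N3)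
        (Pairs.total-weight X typical starDeg (w' * N3) N3 N η (λ p t → ∧-fst {X p} t)
          (*-nonneg (*-nonneg (plus-four {ε} {c} ε0 c-2ε) (plus-four {ε} {b} ε0 b-2ε)) N3-nonneg) N3-nonneg
          weight-bounded (λ p t → proj₂ (typical-weight p t)) size atypical)
    ; link-total = link-total D-pos
    ; mean = trans (ratio-eq (count3 (g123 G)) (count2 (g12 G)) N-pos) (count3-pairs (g123 G))
    ; regular = regular-on-pairs ε0 (proj₂ (proj₂ (proj₂ R)))
    }
    where
    N3-nonneg : NonNeg N3
    N3-nonneg = <⇒≤ N3-pos
    size : Pairs.cnt X ≡ N
    size = cnt-pairs (g12 G)
    w'≤ℓ+σ : w' ≤ ℓ + σ
    w'≤ℓ+σ = cert≤ _ (solve 3 (λ w l η → (l :+ (w :- l :+ η)) :- w := η) refl w' ℓ η) η0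

  conclusion : ∀ ε' (L-pos : 0ℚ < ℓ * N3) (D-ε : NonNeg (D - ε)) (η0 : NonNeg η) →
    Thresholds ε η (ℓ * N3) ((ℓ + σ) * N3) D ε' → ConclusionII ε' G
  conclusion ε' L-pos D-ε η0 thresholds =
    (λ u v → Bad (u , v)) , subst (_≤ ε' * N) (cnt-pairs (λ u v → Bad (u , v))) (proj₁ (proj₂ result)) ,
    (λ u v → proj₂ (proj₂ result) (u , v))
    where
    result = Pairs.Concentration.concentration (system L-pos D-ε η0) ε' thresholds
    Bad = proj₁ result

-- Every inequality below is certified by writing the
-- difference of its two sides as a sum of products of quantities already
-- known to be nonnegative (cert≤, cert<); only the certificates are
-- nontrivial, the verification is ring normalisation.

eighth sixteenth sixth : ℚ
eighth = + 1 / 8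
sixteenth = + 1 / 16
sixth = + 1 / 6

-- Generic conditions for the concentration lemma with L = ℓM and
-- W = (ℓ + σ)M: ℓ ≥ d³/8 is bounded below, while the error terms η, σ, ε
-- fit into the budget ε'd⁴/16.
module ConcentrationNumerics (d ε ε' η D ℓ σ M : ℚ)
  (d-pos : 0ℚ < d) (d≤1 : d ≤ 1ℚ) (ε-pos : 0ℚ < ε) (ε'-pos : 0ℚ < ε') (ε'≤1 : ε' ≤ 1ℚ)
  (d<D : d < D) (D≤1 : D ≤ 1ℚ) (ℓ-lower : eighth * (d * d * d) ≤ ℓ) (ℓ≤1 : ℓ ≤ 1ℚ)
  (σ0 : NonNeg σ) (σ≤ℓ : σ ≤ ℓ) (η0 : NonNeg η) (ε-small : ε ≤ sixth * ε')
  (budget : η + η + σ + ε + ε ≤ sixteenth * (ε' * (d * d * d * d)))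
  (M-pos : 0ℚ < M) where

  d0 = <⇒≤ d-pos
  ε0 = <⇒≤ ε-pos
  ε'0 = <⇒≤ ε'-pos
  D0 : NonNeg D
  D0 = <⇒≤ (<-trans d-pos d<D)
  ℓ0 : NonNeg ℓ
  ℓ0 = ≤-trans σ0 σ≤ℓ
  M0 = <⇒≤ M-pos
  1-d = ≤⇒diff d≤1
  1-D = ≤⇒diff D≤1
  1-ℓ = ≤⇒diff ℓ≤1
  1-ε' = ≤⇒diff ε'≤1
  D-d = ≤⇒diff (<⇒≤ d<D)
  ℓ-ρ = ≤⇒diff ℓ-lower
  ℓ-σ = ≤⇒diff σ≤ℓ
  spare = ≤⇒diff budget
  ε'/6-ε = ≤⇒diff ε-small
  budget-pos : 0ℚ < sixteenth * (ε' * (d * d * d * d))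
  budget-pos = *-pos (positive⁻¹ sixteenth) (*-pos ε'-pos (*-pos (*-pos (*-pos d-pos d-pos) d-pos) d-pos))
  cubic : NonNeg (1ℚ + d + d * d)
  cubic = +-nonneg (+-nonneg (frac-nonneg 1 1) d0) (*-nonneg d0 d0)
  quartic : NonNeg (1ℚ + d + d * d + d * d * d)
  quartic = +-nonneg cubic (*-nonneg (*-nonneg d0 d0) d0)

  D-ε : NonNeg (D - ε)
  D-ε = subst NonNeg (sym (solve 6 (λ d ε ε' η D σ → D :- ε :=
          (D :- d) :+ (con sixteenth :* (ε' :* (d :* d :* d :* d)) :- (η :+ η :+ σ :+ ε :+ ε)) :+ η :+ η :+ σ :+ ε
          :+ d :* (con (+ 15 / 16) :+ con sixteenth :* ((con 1ℚ :- ε') :+ ε' :* ((con 1ℚ :- d) :* (con 1ℚ :+ d :+ d :* d)))))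
          refl d ε ε' η D σ))
    (+-nonneg (+-nonneg (+-nonneg (+-nonneg (+-nonneg (+-nonneg D-d spare) η0) η0) σ0) ε0)
      (*-nonneg d0 (+-nonneg (frac-nonneg 15 16) (*-nonneg (frac-nonneg 1 16) (+-nonneg 1-ε' (*-nonneg ε'0 (*-nonneg 1-d cubic)))))))

  thresholds : Thresholds ε η (ℓ * M) ((ℓ + σ) * M) D ε'
  thresholds = record
    { ε'-nonneg = ε'0
    ; ε'≤1 = ε'≤1
    ; regular-threshold = cert≤ _ (solve 5 (λ ε ε' ℓ σ M → (con third :* ε') :* (ℓ :* M) :- ε :* ((ℓ :+ σ) :* M)
          := M :* ((ℓ :+ ℓ) :* (con sixth :* ε' :- ε)) :+ M :* (ε :* (ℓ :- σ))) refl ε ε' ℓ σ M)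
        (+-nonneg (*-nonneg M0 (*-nonneg (+-nonneg ℓ0 ℓ0) ε'/6-ε)) (*-nonneg M0 (*-nonneg ε0 ℓ-σ)))
    ; upper-gap = cert< _ (solve 8 (λ d ε ε' η D ℓ σ M →
          (con 1ℚ :+ ε') :* (con 1ℚ :- η) :* D :* (ℓ :* M) :- (D :+ ε) :* ((ℓ :+ σ) :* M)
          := M :* (con sixteenth :* (ε' :* (d :* d :* d :* d)) :+
               (ε' :* (D :- d) :* ℓ :+ ε' :* d :* (ℓ :- con eighth :* (d :* d :* d))
               :+ (con sixteenth :* (ε' :* (d :* d :* d :* d)) :- (η :+ η :+ σ :+ ε :+ ε))
               :+ η :* ((con 1ℚ :- D) :+ D :* (con 1ℚ :- ℓ) :+ (con 1ℚ :- ε') :+ ε' :* (con 1ℚ :- D) :+ ε' :* D :* (con 1ℚ :- ℓ))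
               :+ σ :* (con 1ℚ :- D) :+ ε :* (con 1ℚ :- ℓ) :+ ε :* ((con 1ℚ :- ℓ) :+ (ℓ :- σ)))))
          refl d ε ε' η D ℓ σ M)
        (*-pos M-pos (+-pos budget-pos
          (+-nonneg (+-nonneg (+-nonneg (+-nonneg (+-nonneg (+-nonneg (*-nonneg (*-nonneg ε'0 D-d) ℓ0) (*-nonneg (*-nonneg ε'0 d0) ℓ-ρ)) spare)
             (*-nonneg η0 (+-nonneg (+-nonneg (+-nonneg (+-nonneg 1-D (*-nonneg D0 1-ℓ)) 1-ε') (*-nonneg ε'0 1-D)) (*-nonneg (*-nonneg ε'0 D0) 1-ℓ))))
             (*-nonneg σ0 1-D)) (*-nonneg ε0 1-ℓ)) (*-nonneg ε0 (+-nonneg 1-ℓ ℓ-σ)))))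
    ; lower-gap = cert< _ (solve 8 (λ d ε ε' η D ℓ σ M →
          (D :- ε) :* (ℓ :* M) :- (con 1ℚ :- ε') :* D :* ((ℓ :+ σ) :* M)
          := M :* (con sixteenth :* (ε' :* (d :* d :* d :* d)) :+
               (ε' :* (D :- d) :* ℓ :+ ε' :* d :* (ℓ :- con eighth :* (d :* d :* d))
               :+ (con sixteenth :* (ε' :* (d :* d :* d :* d)) :- (η :+ η :+ σ :+ ε :+ ε))
               :+ (η :+ η) :+ σ :* (con 1ℚ :- D) :+ ε :* (con 1ℚ :- ℓ) :+ ε :+ ε' :* D :* σ)))
          refl d ε ε' η D ℓ σ M)
        (*-pos M-pos (+-pos budget-pos
          (+-nonneg (+-nonneg (+-nonneg (+-nonneg (+-nonneg (+-nonneg (+-nonneg (*-nonneg (*-nonneg ε'0 D-d) ℓ0) (*-nonneg (*-nonneg ε'0 d0) ℓ-ρ)) spare)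
             (+-nonneg η0 η0)) (*-nonneg σ0 1-D)) (*-nonneg ε0 1-ℓ)) ε0) (*-nonneg (*-nonneg ε'0 D0) σ0))))
    ; few-atypical = cert≤ _ (solve 5 (λ d ε ε' η σ → con third :* ε' :- η :=
          (con sixteenth :* (ε' :* (d :* d :* d :* d)) :- (η :+ η :+ σ :+ ε :+ ε)) :+ η :+ σ :+ ε :+ ε
          :+ ε' :* (con (+ 13 / 48) :+ con sixteenth :* ((con 1ℚ :- d) :* (con 1ℚ :+ d :+ d :* d :+ d :* d :* d)))) refl d ε ε' η σ)
        (+-nonneg (+-nonneg (+-nonneg (+-nonneg (+-nonneg spare η0) σ0) ε0) ε0)
          (*-nonneg ε'0 (+-nonneg (frac-nonneg 13 48) (*-nonneg (frac-nonneg 1 16) (*-nonneg 1-d quartic)))))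
    }

ε-scale η-scale half : ℚ
ε-scale = + 1 / 1024
η-scale = + 1 / 64
half = + 1 / 2

module SmallEpsilon (d ε ε' : ℚ) (d-pos : 0ℚ < d) (d≤1 : d ≤ 1ℚ) (ε-pos : 0ℚ < ε) (ε'-pos : 0ℚ < ε') (ε'≤1 : ε' ≤ 1ℚ)
  (ε-small : ε ≤ ε-scale * (ε' * (d * d * d * d * d))) where
  d0 = <⇒≤ d-pos
  ε0 = <⇒≤ ε-pos
  ε'0 = <⇒≤ ε'-pos
  1-d = ≤⇒diff d≤1
  1-ε' = ≤⇒diff ε'≤1
  spare = ≤⇒diff ε-small
  2ε0 = +-nonneg ε0 ε0
  4ε0 = +-nonneg (+-nonneg 2ε0 ε0) ε0
  8ε0 = +-nonneg (+-nonneg (+-nonneg (+-nonneg 4ε0 ε0) ε0) ε0) ε0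
  d²0 = *-nonneg d0 d0
  d⁴0 : NonNeg (d * d * d * d)
  d⁴0 = *-nonneg (*-nonneg d²0 d0) d0
  quartic : NonNeg (1ℚ + d + d * d + d * d * d)
  quartic = +-nonneg (+-nonneg (+-nonneg (frac-nonneg 1 1) d0) d²0) (*-nonneg d²0 d0)
  quintic : NonNeg (1ℚ + d + d * d + d * d * d + d * d * d * d)
  quintic = +-nonneg quartic d⁴0

  d-4ε : NonNeg (d - (ε + ε + ε + ε))
  d-4ε = subst NonNeg (sym (solve 3 (λ d ε e → d :- (ε :+ ε :+ ε :+ ε) :=
          con (+ 4 / 1) :* (con ε-scale :* (e :* (d :* d :* d :* d :* d)) :- ε)
          :+ d :* (con (+ 255 / 256) :+ con (+ 1 / 256) :* ((con 1ℚ :- e) :+ e :* ((con 1ℚ :- d) :* (con 1ℚ :+ d :+ d :* d :+ d :* d :* d)))))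
          refl d ε ε'))
    (+-nonneg (*-nonneg (frac-nonneg 4 1) spare)
      (*-nonneg d0 (+-nonneg (frac-nonneg 255 256) (*-nonneg (frac-nonneg 1 256) (+-nonneg 1-ε' (*-nonneg ε'0 (*-nonneg 1-d quartic)))))))

  ε<1 : ε < 1ℚ
  ε<1 = cert< _ (solve 2 (λ d ε → con 1ℚ :- ε := ε :+ ((con 1ℚ :- d) :+ (d :- (ε :+ ε :+ ε :+ ε)) :+ (ε :+ ε))) refl d ε)
    (+-pos ε-pos (+-nonneg (+-nonneg 1-d d-4ε) 2ε0))

  3ε< : ∀ {x} → d < x → ε + ε + ε < x
  3ε< {x} h = cert< _ (solve 3 (λ d ε x → x :- (ε :+ ε :+ ε) := ε :+ ((x :- d) :+ (d :- (ε :+ ε :+ ε :+ ε)))) refl d ε x)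
    (+-pos ε-pos (+-nonneg (≤⇒diff (<⇒≤ h)) d-4ε))

  x-ε : ∀ {x} → d < x → NonNeg (x - ε)
  x-ε {x} h = subst NonNeg (sym (solve 3 (λ d ε x → x :- ε := (x :- d) :+ (d :- (ε :+ ε :+ ε :+ ε)) :+ (ε :+ ε :+ ε)) refl d ε x))
    (+-nonneg (+-nonneg (≤⇒diff (<⇒≤ h)) d-4ε) (+-nonneg 2ε0 ε0))

  x-2ε : ∀ {x} → d < x → NonNeg (x - (ε + ε))
  x-2ε {x} h = subst NonNeg (sym (solve 3 (λ d ε x → x :- (ε :+ ε) := (x :- d) :+ (d :- (ε :+ ε :+ ε :+ ε)) :+ (ε :+ ε)) refl d ε x))
    (+-nonneg (+-nonneg (≤⇒diff (<⇒≤ h)) d-4ε) 2ε0)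

  ε≤ε'/6 : ε ≤ sixth * ε'
  ε≤ε'/6 = cert≤ _ (solve 3 (λ d ε e → con sixth :* e :- ε :=
          (con ε-scale :* (e :* (d :* d :* d :* d :* d)) :- ε)
          :+ e :* (con (+ 509 / 3072) :+ con ε-scale :* ((con 1ℚ :- d) :* (con 1ℚ :+ d :+ d :* d :+ d :* d :* d :+ d :* d :* d :* d)))) refl d ε ε')
    (+-nonneg spare (*-nonneg ε'0 (+-nonneg (frac-nonneg 509 3072) (*-nonneg (frac-nonneg 1 1024) (*-nonneg 1-d quintic)))))

  budget≤eighth : sixteenth * (ε' * (d * d * d * d)) ≤ eighth * (d * d * d)
  budget≤eighth = cert≤ _ (solve 2 (λ d e → con eighth :* (d :* d :* d) :- con sixteenth :* (e :* (d :* d :* d :* d)) :=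
           (d :* d :* d) :* (con sixteenth :+ con sixteenth :* ((con 1ℚ :- e) :+ e :* (con 1ℚ :- d)))) refl d ε')
    (*-nonneg (*-nonneg d²0 d0) (+-nonneg (frac-nonneg 1 16) (*-nonneg (frac-nonneg 1 16) (+-nonneg 1-ε' (*-nonneg ε'0 1-d)))))

  eighth-pos : 0ℚ < eighth * (d * d * d)
  eighth-pos = *-pos (positive⁻¹ eighth) (*-pos (*-pos d-pos d-pos) d-pos)

  half-d0 : NonNeg (half * d)
  half-d0 = *-nonneg (frac-nonneg 1 2) d0
  half-d-4ε : NonNeg (half * (d - (ε + ε + ε + ε)))
  half-d-4ε = *-nonneg (frac-nonneg 1 2) d-4ε

  module PartINumbers (a b c : ℚ) (d<a : d < a) (d<b : d < b) (d<c : d < c) (a≤1 : a ≤ 1ℚ) (b≤1 : b ≤ 1ℚ) (c≤1 : c ≤ 1ℚ) where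
    ℓ w' η σ : ℚ
    ℓ = (c - ε) * ((a - (ε + ε)) * (b - (ε + ε)))
    w' = (c + ε) * ((a + (ε + ε)) * (b + (ε + ε)))
    η = ε + ε + ε + ε
    σ = w' - ℓ + η
    1-a = ≤⇒diff a≤1
    1-b = ≤⇒diff b≤1
    1-c = ≤⇒diff c≤1
    a0 = <⇒≤ (<-trans d-pos d<a)
    b0 = <⇒≤ (<-trans d-pos d<b)
    c0 = <⇒≤ (<-trans d-pos d<c)
    1-ε = ≤⇒diff (<⇒≤ ε<1)
    a-2ε = x-2ε d<a
    b-2ε = x-2ε d<b
    c-ε = x-ε d<c

    η0 : NonNeg η
    η0 = 4ε0

    σ-expanded : σ ≡ (ε + ε) * (a * b) + (ε + ε + ε + ε) * (b * c) + (ε + ε + ε + ε) * (c * a) + (ε + ε + ε + ε + ε + ε + ε + ε) * (ε * ε) + η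
    σ-expanded = solve 4 (λ a b c ε → (c :+ ε) :* ((a :+ (ε :+ ε)) :* (b :+ (ε :+ ε))) :- (c :- ε) :* ((a :- (ε :+ ε)) :* (b :- (ε :+ ε))) :+ (ε :+ ε :+ ε :+ ε)
      := (ε :+ ε) :* (a :* b) :+ (ε :+ ε :+ ε :+ ε) :* (b :* c) :+ (ε :+ ε :+ ε :+ ε) :* (c :* a) :+ (ε :+ ε :+ ε :+ ε :+ ε :+ ε :+ ε :+ ε) :* (ε :* ε) :+ (ε :+ ε :+ ε :+ ε)) refl a b c ε

    σ0 : NonNeg σ
    σ0 = subst NonNeg (sym σ-expanded) (+-nonneg (+-nonneg (+-nonneg (+-nonneg (*-nonneg 2ε0 (*-nonneg a0 b0)) (*-nonneg η0 (*-nonneg b0 c0)))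
      (*-nonneg η0 (*-nonneg c0 a0))) (*-nonneg 8ε0 (*-nonneg ε0 ε0))) η0)

    budget : η + η + σ + ε + ε ≤ sixteenth * (ε' * (d * d * d * d))
    budget = cert≤ _ (trans (cong (λ s → sixteenth * (ε' * (d * d * d * d)) - (η + η + s + ε + ε)) σ-expanded)
      (solve 6 (λ d ε e a b c →
        con sixteenth :* (e :* (d :* d :* d :* d)) :- ((ε :+ ε :+ ε :+ ε) :+ (ε :+ ε :+ ε :+ ε) :+
          ((ε :+ ε) :* (a :* b) :+ (ε :+ ε :+ ε :+ ε) :* (b :* c) :+ (ε :+ ε :+ ε :+ ε) :* (c :* a) :+ (ε :+ ε :+ ε :+ ε :+ ε :+ ε :+ ε :+ ε) :* (ε :* ε) :+ (ε :+ ε :+ ε :+ ε)) :+ ε :+ ε)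
        := con (+ 32 / 1) :* (con ε-scale :* (e :* (d :* d :* d :* d :* d)) :- ε) :+ (e :* (d :* d :* d :* d)) :* (con (+ 1 / 32) :+ con (+ 1 / 32) :* (con 1ℚ :- d))
           :+ (ε :+ ε) :* ((con 1ℚ :- a) :+ a :* (con 1ℚ :- b)) :+ (ε :+ ε :+ ε :+ ε) :* ((con 1ℚ :- b) :+ b :* (con 1ℚ :- c))
           :+ (ε :+ ε :+ ε :+ ε) :* ((con 1ℚ :- c) :+ c :* (con 1ℚ :- a)) :+ (ε :+ ε :+ ε :+ ε :+ ε :+ ε :+ ε :+ ε) :* ((con 1ℚ :- ε) :* (con 1ℚ :+ ε)))
        refl d ε ε' a b c))
      (+-nonneg (+-nonneg (+-nonneg (+-nonneg (+-nonneg (*-nonneg (frac-nonneg 32 1) spare) (*-nonneg (*-nonneg ε'0 d⁴0) (+-nonneg (frac-nonneg 1 32) (*-nonneg (frac-nonneg 1 32) 1-d))))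
         (*-nonneg 2ε0 (+-nonneg 1-a (*-nonneg a0 1-b)))) (*-nonneg η0 (+-nonneg 1-b (*-nonneg b0 1-c)))) (*-nonneg η0 (+-nonneg 1-c (*-nonneg c0 1-a))))
         (*-nonneg 8ε0 (*-nonneg 1-ε (+-nonneg (frac-nonneg 1 1) ε0))))

    ℓ-lower : eighth * (d * d * d) ≤ ℓ
    ℓ-lower = cert≤ _ (solve 5 (λ d ε a b c →
        (c :- ε) :* ((a :- (ε :+ ε)) :* (b :- (ε :+ ε))) :- con eighth :* (d :* d :* d)
        := ((c :- d) :+ (con half :* (d :- (ε :+ ε :+ ε :+ ε)) :+ ε)) :* ((a :- (ε :+ ε)) :* (b :- (ε :+ ε)))
           :+ (con half :* d) :* ((a :- d) :+ con half :* (d :- (ε :+ ε :+ ε :+ ε))) :* (b :- (ε :+ ε))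
           :+ (con half :* d) :* (con half :* d) :* ((b :- d) :+ con half :* (d :- (ε :+ ε :+ ε :+ ε)))) refl d ε a b c)
      (+-nonneg (+-nonneg (*-nonneg (+-nonneg (≤⇒diff (<⇒≤ d<c)) (+-nonneg half-d-4ε ε0)) (*-nonneg a-2ε b-2ε))
                          (*-nonneg (*-nonneg half-d0 (+-nonneg (≤⇒diff (<⇒≤ d<a)) half-d-4ε)) b-2ε))
                (*-nonneg (*-nonneg half-d0 half-d0) (+-nonneg (≤⇒diff (<⇒≤ d<b)) half-d-4ε)))

    ℓ≤1 : ℓ ≤ 1ℚ
    ℓ≤1 = cert≤ _ (solve 4 (λ ε a b c → con 1ℚ :- (c :- ε) :* ((a :- (ε :+ ε)) :* (b :- (ε :+ ε)))
        := ((con 1ℚ :- c) :+ ε) :+ (c :- ε) :* ((con 1ℚ :- a) :+ (ε :+ ε)) :+ (c :- ε) :* (a :- (ε :+ ε)) :* ((con 1ℚ :- b) :+ (ε :+ ε))) refl ε a b c)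
      (+-nonneg (+-nonneg (+-nonneg 1-c ε0) (*-nonneg c-ε (+-nonneg 1-a 2ε0))) (*-nonneg (*-nonneg c-ε a-2ε) (+-nonneg 1-b 2ε0)))

    σ≤ℓ : σ ≤ ℓ
    σ≤ℓ = ≤-trans (cert≤ _ (solve 3 (λ η σ ε → η :+ η :+ σ :+ ε :+ ε :- σ := (η :+ η) :+ (ε :+ ε)) refl η σ ε) (+-nonneg (+-nonneg η0 η0) 2ε0))
                  (≤-trans budget (≤-trans budget≤eighth ℓ-lower))

  -- The quantities of part (ii); here η = ε'd⁴/64 absorbs 4ε/d12.
  module PartIINumbers (a b c : ℚ) (d<a : d < a) (d<b : d < b) (d<c : d < c) (b≤1 : b ≤ 1ℚ) (c≤1 : c ≤ 1ℚ) where
    ℓ w' η σ : ℚ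
    ℓ = (c - (ε + ε)) * (b - (ε + ε))
    w' = (c + (ε + ε)) * (b + (ε + ε))
    η = η-scale * (ε' * (d * d * d * d))
    σ = w' - ℓ + η
    1-b = ≤⇒diff b≤1
    1-c = ≤⇒diff c≤1
    b0 = <⇒≤ (<-trans d-pos d<b)
    c0 = <⇒≤ (<-trans d-pos d<c)
    b-2ε = x-2ε d<b
    c-2ε = x-2ε d<c

    η0 : NonNeg η
    η0 = *-nonneg (frac-nonneg 1 64) (*-nonneg ε'0 d⁴0)

    σ-expanded : σ ≡ (ε + ε + ε + ε) * b + (ε + ε + ε + ε) * c + η
    σ-expanded = solve 4 (λ b c ε η → (c :+ (ε :+ ε)) :* (b :+ (ε :+ ε)) :- (c :- (ε :+ ε)) :* (b :- (ε :+ ε)) :+ η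
      := (ε :+ ε :+ ε :+ ε) :* b :+ (ε :+ ε :+ ε :+ ε) :* c :+ η) refl b c ε η

    σ0 : NonNeg σ
    σ0 = subst NonNeg (sym σ-expanded) (+-nonneg (+-nonneg (*-nonneg 4ε0 b0) (*-nonneg 4ε0 c0)) η0)

    budget : η + η + σ + ε + ε ≤ sixteenth * (ε' * (d * d * d * d))
    budget = cert≤ _ (trans (cong (λ s → sixteenth * (ε' * (d * d * d * d)) - (η + η + s + ε + ε)) σ-expanded)
      (solve 5 (λ d ε e b c →
        con sixteenth :* (e :* (d :* d :* d :* d)) :- (con η-scale :* (e :* (d :* d :* d :* d)) :+ con η-scale :* (e :* (d :* d :* d :* d))
           :+ ((ε :+ ε :+ ε :+ ε) :* b :+ (ε :+ ε :+ ε :+ ε) :* c :+ con η-scale :* (e :* (d :* d :* d :* d))) :+ ε :+ ε)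
        := con (+ 10 / 1) :* (con ε-scale :* (e :* (d :* d :* d :* d :* d)) :- ε)
           :+ (e :* (d :* d :* d :* d)) :* (con (+ 6 / 1024) :+ con (+ 10 / 1024) :* (con 1ℚ :- d))
           :+ (ε :+ ε :+ ε :+ ε) :* (con 1ℚ :- b) :+ (ε :+ ε :+ ε :+ ε) :* (con 1ℚ :- c))
        refl d ε ε' b c))
      (+-nonneg (+-nonneg (+-nonneg (*-nonneg (frac-nonneg 10 1) spare) (*-nonneg (*-nonneg ε'0 d⁴0) (+-nonneg (frac-nonneg 6 1024) (*-nonneg (frac-nonneg 10 1024) 1-d))))
         (*-nonneg 4ε0 1-b)) (*-nonneg 4ε0 1-c))

    η-bound : ε + ε + ε + ε ≤ η * a
    η-bound = cert≤ _ (solve 4 (λ d ε e a → con η-scale :* (e :* (d :* d :* d :* d)) :* a :- (ε :+ ε :+ ε :+ ε)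
        := con η-scale :* (e :* (d :* d :* d :* d)) :* (a :- d) :+ con (+ 4 / 1) :* (con ε-scale :* (e :* (d :* d :* d :* d :* d)) :- ε)
           :+ con (+ 3 / 256) :* (e :* (d :* d :* d :* d)) :* d) refl d ε ε' a)
      (+-nonneg (+-nonneg (*-nonneg η0 (≤⇒diff (<⇒≤ d<a))) (*-nonneg (frac-nonneg 4 1) spare)) (*-nonneg (*-nonneg (frac-nonneg 3 256) (*-nonneg ε'0 d⁴0)) d0))

    ℓ-lower : eighth * (d * d * d) ≤ ℓ
    ℓ-lower = cert≤ _ (solve 4 (λ d ε b c →
        (c :- (ε :+ ε)) :* (b :- (ε :+ ε)) :- con eighth :* (d :* d :* d)
        := ((c :- d) :+ con half :* (d :- (ε :+ ε :+ ε :+ ε))) :* (b :- (ε :+ ε))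
           :+ (con half :* d) :* ((b :- d) :+ con half :* (d :- (ε :+ ε :+ ε :+ ε)))
           :+ con eighth :* (d :* d) :* (con 1ℚ :+ (con 1ℚ :- d))) refl d ε b c)
      (+-nonneg (+-nonneg (*-nonneg (+-nonneg (≤⇒diff (<⇒≤ d<c)) half-d-4ε) b-2ε) (*-nonneg half-d0 (+-nonneg (≤⇒diff (<⇒≤ d<b)) half-d-4ε)))
                (*-nonneg (*-nonneg (frac-nonneg 1 8) d²0) (+-nonneg (frac-nonneg 1 1) 1-d)))

    ℓ≤1 : ℓ ≤ 1ℚ
    ℓ≤1 = cert≤ _ (solve 3 (λ ε b c → con 1ℚ :- (c :- (ε :+ ε)) :* (b :- (ε :+ ε))
        := ((con 1ℚ :- c) :+ (ε :+ ε)) :+ (c :- (ε :+ ε)) :* ((con 1ℚ :- b) :+ (ε :+ ε))) refl ε b c)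
      (+-nonneg (+-nonneg 1-c 2ε0) (*-nonneg c-2ε (+-nonneg 1-b 2ε0)))

    σ≤ℓ : σ ≤ ℓ
    σ≤ℓ = ≤-trans (cert≤ _ (solve 3 (λ η σ ε → η :+ η :+ σ :+ ε :+ ε :- σ := (η :+ η) :+ (ε :+ ε)) refl η σ ε) (+-nonneg (+-nonneg η0 η0) 2ε0))
                  (≤-trans budget (≤-trans budget≤eighth ℓ-lower))

module MainArgument (d ε' ε : ℚ) (d-pos : 0ℚ < d) (ε'-pos : 0ℚ < ε') (ε'≤1 : ε' ≤ 1ℚ) (ε-pos : 0ℚ < ε)
  (ε-small : ε ≤ ε-scale * (ε' * (d * d * d * d * d)))
  {n₁ n₂ n₃ : ℕ} (G : Complex3 n₁ n₂ n₃) (R : Regular ε G) (dense : DensitiesAbove d G) where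

  open ComplexFacts G using (d12≤1; d13≤1; d23≤1; d123≤1)

  d<d1 = proj₁ dense
  d<d2 = proj₁ (proj₂ dense)
  d<d3 = proj₁ (proj₂ (proj₂ dense))
  d<a = proj₁ (proj₂ (proj₂ (proj₂ dense)))
  d<b = proj₁ (proj₂ (proj₂ (proj₂ (proj₂ dense))))
  d<c = proj₁ (proj₂ (proj₂ (proj₂ (proj₂ (proj₂ dense)))))
  d<D = proj₂ (proj₂ (proj₂ (proj₂ (proj₂ (proj₂ dense)))))

  -- Positive vertex densities force nonempty vertex classes.
  N1-pos = proj₁ (ratio-pos (count (g1 G)) n₁ (<-trans d-pos d<d1))
  N2-pos = proj₁ (ratio-pos (count (g2 G)) n₂ (<-trans d-pos d<d2))
  N3-pos = proj₁ (ratio-pos (count (g3 G)) n₃ (<-trans d-pos d<d3))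
  D-pos = <-trans d-pos d<D
  d≤1 = <⇒≤ (<-≤-trans d<a d12≤1)

  open SmallEpsilon d ε ε' d-pos d≤1 ε-pos ε'-pos ε'≤1 ε-small

  part-i : ConclusionI ε' G
  part-i = P.conclusion ε' L-pos C.D-ε C.thresholds
    where
    module Q = PartINumbers (d12 G) (d13 G) (d23 G) d<a d<b d<c d12≤1 d13≤1 d23≤1
    module P = PartI G ε ε-pos R N1-pos N2-pos N3-pos ε<1 (3ε< d<a) (3ε< d<b) (x-ε d<c) D-pos
    M-pos = *-pos N2-pos N3-pos
    module C = ConcentrationNumerics d ε ε' Q.η (d123 G) Q.ℓ Q.σ P.M d-pos d≤1 ε-pos ε'-pos ε'≤1
      d<D d123≤1 Q.ℓ-lower Q.ℓ≤1 Q.σ0 Q.σ≤ℓ Q.η0 ε≤ε'/6 Q.budget M-pos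
    L-pos = *-pos (<-≤-trans eighth-pos Q.ℓ-lower) M-pos

  part-ii : ConclusionII ε' G
  part-ii = P.conclusion ε' L-pos C.D-ε Q.η0 C.thresholds
    where
    module Q = PartIINumbers (d12 G) (d13 G) (d23 G) d<a d<b d<c d13≤1 d23≤1
    module P = PartII G ε ε-pos R N1-pos N2-pos N3-pos ε<1 (3ε< d<b) (3ε< d<c) D-pos (<-trans d-pos d<a) Q.η Q.η-bound
    module C = ConcentrationNumerics d ε ε' Q.η (d123 G) Q.ℓ Q.σ P.N3 d-pos d≤1 ε-pos ε'-pos ε'≤1
      d<D d123≤1 Q.ℓ-lower Q.ℓ≤1 Q.σ0 Q.σ≤ℓ Q.η0 ε≤ε'/6 Q.budget N3-pos
    L-pos = *-pos (<-≤-trans eighth-pos Q.ℓ-lower) N3-pos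

lemma4p12 : ∀ (d : ℚ) → 0ℚ < d →
    Σ ℚ λ ε'₀ → 0ℚ < ε'₀ × (∀ (ε' : ℚ) → 0ℚ < ε' → ε' ≤ ε'₀ →
    Σ ℚ λ ε₀ → 0ℚ < ε₀ × (∀ (ε : ℚ) → 0ℚ < ε → ε ≤ ε₀ →
    ∀ (n₁ n₂ n₃ : ℕ) (G : Complex3 n₁ n₂ n₃) →
    Regular ε G → DensitiesAbove d G →
    ConclusionI ε' G × ConclusionII ε' G))
lemma4p12 d d-pos = 1ℚ , positive⁻¹ 1ℚ , λ ε' ε'-pos ε'≤1 →
  ε-scale * (ε' * (d * d * d * d * d)) ,
  *-pos (positive⁻¹ ε-scale) (*-pos ε'-pos (*-pos (*-pos (*-pos (*-pos d-pos d-pos) d-pos) d-pos) d-pos)) ,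
  λ ε ε-pos ε-small n₁ n₂ n₃ G R dense →
    let open MainArgument d ε' ε d-pos ε'-pos ε'≤1 ε-pos ε-small G R dense in part-i , part-ii
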